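{- Let $n\ge 7$. Then the set $\{\eta(\Gamma(G)) : \Gamma(G) \text{ an unbalanced signed graph with } G\in B_n^+\}$ equals $\{0,1,2,\ldots,n-6\}$.
   Context: A signed graph $\Gamma(G)=(G,\sigma)$ consists of a simple graph $G$ and a map $\sigma:E(G)\to\{+,-\}$; its adjacency matrix has entry $\sigma(v_iv_j)$ for edges and $0$ otherwise, and $\eta(\Gamma(G))$ is the multiplicity of $0$ as an eigenvalue. A cycle is positive if it has an even number of negative edges; $\Gamma(G)$ is balanced if all its cycles are positive, and unbalanced otherwise. A bicyclic graph is a connected simple graph with $|E|=|V|+1$. The graph $\infty(p,q,l)$ ($p,q\ge3$, $l\ge1$) is obtained from vertex-disjoint cycles $C_p$, $C_q$ by joining a vertex of $C_p$ to a vertex of $C_q$ by a path on $l$ vertices (identifying the two vertices when $l=1$). $B_n^+$ is the set of bicyclic graphs on $n$ vertices obtained from some $\infty(p,q,l)$ with $l>1$ by (possibly) attaching trees to some of its vertices. -}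

module Defs where

open import Data.Nat using (ℕ; zero; suc; _+_; _≤_; _<ᵇ_)
open import Data.Fin using (Fin; toℕ)
open import Data.Bool using (Bool; true; false; if_then_else_; _∧_)
open import Data.List using (List; []; _∷_; _++_; [_]; length; head)
open import Data.List.Relation.Unary.Unique.Propositional using (Unique)
open import Data.Product using (Σ; ∃; _×_; _,_)
open import Relation.Binary.PropositionalEquality using (_≡_; _≢_)
open import Relation.Nullary using (¬_)
open import Data.Unit using (⊤)
open import Data.Empty using (⊥)
open import Data.Rational using (ℚ; 0ℚ; 1ℚ; -_) renaming (_+_ to _+ℚ_; _*_ to _*ℚ_)

data Entry : Set where
  none plus minus : Entry

record SignedGraph (n : ℕ) : Set where
  field
    σ     : Fin n → Fin n → Entry
    sym   : ∀ i j → σ i j ≡ σ j i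
    loopless : ∀ i → σ i i ≡ none
open SignedGraph public

Adj : ∀ {n} → SignedGraph n → Fin n → Fin n → Set
Adj Γ i j = σ Γ i j ≢ none

sumℕ : ∀ {n} → (Fin n → ℕ) → ℕ
sumℕ {zero}  f = 0
sumℕ {suc n} f = f Data.Fin.zero + sumℕ (λ i → f (Data.Fin.suc i))

sumℚ : ∀ {n} → (Fin n → ℚ) → ℚ
sumℚ {zero}  f = 0ℚ
sumℚ {suc n} f = f Data.Fin.zero +ℚ sumℚ (λ i → f (Data.Fin.suc i))

isEdgeᵇ : Entry → Bool
isEdgeᵇ none = false
isEdgeᵇ plus = true
isEdgeᵇ minus = true

edgeCount : ∀ {n} → SignedGraph n → ℕ
edgeCount {n} Γ =
  sumℕ (λ i → sumℕ (λ j → if (toℕ i <ᵇ toℕ j) ∧ isEdgeᵇ (σ Γ i j) then 1 else 0))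

Consec : ∀ {n} → SignedGraph n → List (Fin n) → Set
Consec Γ []           = ⊤
Consec Γ (x ∷ [])     = ⊤
Consec Γ (x ∷ y ∷ xs) = Adj Γ x y × Consec Γ (y ∷ xs)

WalkFromTo : ∀ {n} → SignedGraph n → Fin n → Fin n → List (Fin n) → Set
WalkFromTo Γ i j vs = Consec Γ (i ∷ vs ++ [ j ]) 

Connected : ∀ {n} → SignedGraph n → Set
Connected {n} Γ = ∀ (i j : Fin n) → ∃ λ vs → WalkFromTo Γ i j vs

-- closing edge of a cycle listed as v₀ … v_{k-1}: v_{k-1} ~ v₀
lastAdjFirst : ∀ {n} → SignedGraph n → List (Fin n) → Set
lastAdjFirst Γ [] = ⊥
lastAdjFirst Γ (x ∷ xs) = go x xs
  where
    go : _ → List _ → Set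
    go y []       = Adj Γ y x
    go y (z ∷ zs) = go z zs

IsCycle : ∀ {n} → SignedGraph n → List (Fin n) → Set
IsCycle Γ vs = (3 ≤ length vs) × Unique vs × Consec Γ vs × lastAdjFirst Γ vs

negCount : ∀ {n} → SignedGraph n → List (Fin n) → ℕ
negCount Γ [] = 0
negCount Γ (x ∷ xs) = go x xs
  where
    neg : Entry → ℕ
    neg minus = 1
    neg _     = 0
    go : _ → List _ → ℕ
    go y []       = neg (σ Γ y x)
    go y (z ∷ zs) = neg (σ Γ y z) + go z zs

open import Data.Nat.Base using (_%_)

Unbalanced : ∀ {n} → SignedGraph n → Set
Unbalanced Γ = ∃ λ vs → IsCycle Γ vs × negCount Γ vs % 2 ≡ 1

Bicyclic : ∀ {n} → SignedGraph n → Set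
Bicyclic {n} Γ = Connected Γ × edgeCount Γ ≡ suc n

-- Γ contains ∞(p,q,l) with l > 1 as a subgraph:
--   c₁ = u₀ … u_{p-1} a p-cycle, c₂ = x₀ … x_{q-1} a q-cycle,
--   path u₀ w₁ … w_{l-2} x₀ on l ≥ 2 vertices, all listed vertices distinct.
ContainsInfinity : ∀ {n} → SignedGraph n → Set
ContainsInfinity {n} Γ =
  Σ (Fin n) λ u₀ → Σ (List (Fin n)) λ us →
  Σ (Fin n) λ x₀ → Σ (List (Fin n)) λ xs →
  Σ (List (Fin n)) λ ws →
    IsCycle Γ (u₀ ∷ us) × IsCycle Γ (x₀ ∷ xs) ×
    Consec Γ (u₀ ∷ ws ++ [ x₀ ]) ×
    Unique ((u₀ ∷ us) ++ ws ++ (x₀ ∷ xs))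

InBnPlus : ∀ {n} → SignedGraph n → Set
InBnPlus Γ = Bicyclic Γ × ContainsInfinity Γ

-- nullity: multiplicity of 0 as an eigenvalue of the (real symmetric)
-- adjacency matrix = dim ker A (computed over ℚ, equal to that over ℝ).

entryℚ : Entry → ℚ
entryℚ none  = 0ℚ
entryℚ plus  = 1ℚ
entryℚ minus = - 1ℚ

InKernel : ∀ {n} → SignedGraph n → (Fin n → ℚ) → Set
InKernel {n} Γ x = ∀ i → sumℚ (λ j → entryℚ (σ Γ i j) *ℚ x j) ≡ 0ℚ

LinIndep : ∀ {n k} → (Fin k → Fin n → ℚ) → Set
LinIndep {n} {k} v =
  ∀ (c : Fin k → ℚ) → (∀ i → sumℚ (λ t → c t *ℚ v t i) ≡ 0ℚ) → ∀ t → c t ≡ 0ℚ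

KernelHasIndep : ∀ {n} → SignedGraph n → ℕ → Set
KernelHasIndep {n} Γ k =
  Σ (Fin k → Fin n → ℚ) λ v → (∀ t → InKernel Γ (v t)) × LinIndep v

Nullity : ∀ {n} → SignedGraph n → ℕ → Set
Nullity Γ k = KernelHasIndep Γ k × (∀ m → KernelHasIndep Γ m → m ≤ k)

{-# OPTIONS --safe #-}

-- Let Γ be bicyclic and contain ∞(p, q, l) with l ≥ 2. Adding the vertices outside the
-- ∞-subgraph one at a time along walks, each brings at least one new edge; as |E| = |V| + 1 and ∞(p, q, l)
-- already has one edge more than vertices, no further edge joins two of its vertices: the ∞-subgraph is
-- induced. In it, together with one neighbouring vertex when p = q = 3 and l = 2 (there is one, as n ≥ 7),
-- six rows and columns of the adjacency matrix form a triangular submatrix with nonzero diagonal, so the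
-- rank is at least 6.
--
-- A negative triangle 0 1 2 joined by the edge 0 3 to a positive 4-cycle 3 4 5 6, with n − 7
-- pendants at 0, has nullity n − 6: its kernel is spanned by e₄ − e₆ and the e_s − e₃ + e₅ for the pendants s,
-- and pivoting on six rows shows that nothing else is in it. For k ≤ n − 7, join the negative triangle by
-- the edge 0 3 to a positive triangle 3 4 5, hang k + 1 pendants from 0 and a path from 3. The pendants are
-- twins, giving k kernel vectors; a kernel vector vanishing on k of them is 0 on 0 1 2, and along 3 and the
-- path it takes the values 1, 2, −1, −2, 1, … times its value at 3; as these never vanish but the value
-- beyond the end of the path is 0, the vector is 0.
module Submission where

open import Defs hiding (sym)
open import Data.Nat as N using (ℕ; zero; suc; _≤_; _<_; z≤n; s≤s; _∸_)
import Data.Nat.Properties as NP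
open import Data.Fin as F using (Fin; toℕ; punchIn)
import Data.Fin.Properties as FP
open import Data.Bool using (Bool; true; false; if_then_else_; _∧_; _∨_; T)
import Data.Bool.Properties as BP
open import Data.List as L using (List; []; _∷_; _++_; [_]; length)
import Data.List.Properties as LP
open import Data.List.Membership.Propositional using (_∈_; _∉_)
open import Data.List.Membership.Propositional.Properties using (∈-++⁺ˡ; ∈-++⁺ʳ; ∈-map⁺; ∈-allFin)
import Data.List.Membership.DecPropositional as DecMembership
open import Data.List.Relation.Unary.Any using (here; there)
open import Data.List.Relation.Unary.All as All using (All; []; _∷_)
open import Data.List.Relation.Unary.Unique.Propositional using (Unique)
import Data.List.Relation.Unary.Unique.Propositional.Properties as UniqueP
open import Data.List.Relation.Unary.AllPairs as AllPairs using ([]; _∷_)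
open import Data.Product using (Σ; ∃; _×_; _,_; proj₁; proj₂)
open import Data.Sum using (_⊎_; inj₁; inj₂; [_,_]′)
open import Data.Empty using (⊥-elim)
open import Data.Unit using (⊤; tt)
open import Data.List.Relation.Binary.Sublist.Propositional as Sublist using (_⊆_; []; _∷_; _∷ʳ_; minimum)
open import Data.List.Relation.Binary.Sublist.Propositional.Properties using (++⁺ˡ)
open import Data.Vec.Functional using (insertAt)
open import Data.Vec.Functional.Properties using (insertAt-lookup; insertAt-punchIn)
open import Function using (_∘_)
open import Function.Bundles using (_⇔_; mk⇔)
open import Relation.Nullary using (¬_; Dec; yes; no; does; ¬?)
open import Relation.Nullary.Decidable using (True; dec-true; dec-false; decidable-stable; toWitness)
open import Relation.Binary.PropositionalEquality hiding ([_])
open import Relation.Binary.Definitions using (tri<; tri≈; tri>)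
open import Data.Rational as Q using (ℚ; 0ℚ; 1ℚ)
import Data.Rational.Properties as QP
open import Data.Rational.Solver using (module +-*-Solver)
open +-*-Solver using (solve; _:+_; _:*_; :-_; _:=_; con)
open import Algebra.Bundles using (CommutativeRing)
import Algebra.Properties.Semiring.Sum as SemiringSum

module Σℚ = SemiringSum (CommutativeRing.semiring QP.+-*-commutativeRing)
module Σℕ = SemiringSum NP.+-*-semiring

sumℚ≡sum : ∀ {n} (f : Fin n → ℚ) → sumℚ f ≡ Σℚ.sum f
sumℚ≡sum {zero} f = refl
sumℚ≡sum {suc n} f = cong (f F.zero Q.+_) (sumℚ≡sum (f ∘ F.suc))

sumℕ≡sum : ∀ {n} (f : Fin n → ℕ) → sumℕ f ≡ Σℕ.sum f
sumℕ≡sum {zero} f = refl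
sumℕ≡sum {suc n} f = cong (f F.zero N.+_) (sumℕ≡sum (f ∘ F.suc))

sumℚ-cong : ∀ {n} {f g : Fin n → ℚ} → f ≗ g → sumℚ f ≡ sumℚ g
sumℚ-cong {f = f} {g} f≗g rewrite sumℚ≡sum f | sumℚ≡sum g = Σℚ.sum-cong-≗ f≗g

sumℚ-zero : ∀ {n} {f : Fin n → ℚ} → f ≗ (λ _ → 0ℚ) → sumℚ f ≡ 0ℚ
sumℚ-zero {n} f≗0 = trans (sumℚ-cong f≗0) (trans (sumℚ≡sum {n} (λ _ → 0ℚ)) (Σℚ.sum-replicate-zero n))

sumℚ-+ : ∀ {n} (f g : Fin n → ℚ) → sumℚ (λ i → f i Q.+ g i) ≡ sumℚ f Q.+ sumℚ g
sumℚ-+ f g rewrite sumℚ≡sum f | sumℚ≡sum g | sumℚ≡sum (λ i → f i Q.+ g i) = Σℚ.∑-distrib-+ f g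

sumℚ-*ˡ : ∀ {n} (a : ℚ) (f : Fin n → ℚ) → sumℚ (λ i → a Q.* f i) ≡ a Q.* sumℚ f
sumℚ-*ˡ a f rewrite sumℚ≡sum f | sumℚ≡sum (λ i → a Q.* f i) = sym (Σℚ.*-distribˡ-sum a f)

sumℚ-*ʳ : ∀ {n} (a : ℚ) (f : Fin n → ℚ) → sumℚ (λ i → f i Q.* a) ≡ sumℚ f Q.* a
sumℚ-*ʳ a f rewrite sumℚ≡sum f | sumℚ≡sum (λ i → f i Q.* a) = sym (Σℚ.*-distribʳ-sum a f)

sumℚ-neg : ∀ {n} (f : Fin n → ℚ) → sumℚ (λ i → Q.- f i) ≡ Q.- sumℚ f
sumℚ-neg f = begin
  sumℚ (λ i → Q.- f i)           ≡⟨ sumℚ-cong (λ i → solve 1 (λ x → :- x := :- con 1ℚ :* x) refl (f i)) ⟩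
  sumℚ (λ i → Q.- 1ℚ Q.* f i)    ≡⟨ sumℚ-*ˡ (Q.- 1ℚ) f ⟩
  Q.- 1ℚ Q.* sumℚ f              ≡⟨ solve 1 (λ x → :- con 1ℚ :* x := :- x) refl (sumℚ f) ⟩
  Q.- sumℚ f                     ∎
  where open ≡-Reasoning

sumℚ-swap : ∀ {n m} (f : Fin n → Fin m → ℚ) →
  sumℚ (λ i → sumℚ (f i)) ≡ sumℚ (λ j → sumℚ (λ i → f i j))
sumℚ-swap {zero} {m} f = sym (sumℚ-zero {m} (λ _ → refl))
sumℚ-swap {suc n} f = trans (cong (sumℚ (f F.zero) Q.+_) (sumℚ-swap (f ∘ F.suc)))
  (sym (sumℚ-+ (f F.zero) (λ j → sumℚ (λ i → f (F.suc i) j))))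

sumℚ-punchIn : ∀ {k} (t₀ : Fin (suc k)) (f : Fin (suc k) → ℚ) →
  sumℚ f ≡ f t₀ Q.+ sumℚ (f ∘ punchIn t₀)
sumℚ-punchIn t₀ f rewrite sumℚ≡sum f | sumℚ≡sum (f ∘ punchIn t₀) = Σℚ.sum-remove {i = t₀} f

sumℚ-single : ∀ {n} (a : Fin n) (f : Fin n → ℚ) → (∀ j → j ≢ a → f j ≡ 0ℚ) → sumℚ f ≡ f a
sumℚ-single {suc n} a f off = begin
  sumℚ f                           ≡⟨ sumℚ-punchIn a f ⟩
  f a Q.+ sumℚ (f ∘ punchIn a)     ≡⟨ cong (f a Q.+_) (sumℚ-zero (λ t → off (punchIn a t) (FP.punchInᵢ≢i a t))) ⟩
  f a Q.+ 0ℚ                       ≡⟨ QP.+-identityʳ (f a) ⟩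
  f a                              ∎
  where open ≡-Reasoning

sumℕ-cong : ∀ {n} {f g : Fin n → ℕ} → f ≗ g → sumℕ f ≡ sumℕ g
sumℕ-cong {f = f} {g} f≗g rewrite sumℕ≡sum f | sumℕ≡sum g = Σℕ.sum-cong-≗ f≗g

sumℕ-zero : ∀ {n} {f : Fin n → ℕ} → f ≗ (λ _ → 0) → sumℕ f ≡ 0
sumℕ-zero {n} f≗0 = trans (sumℕ-cong f≗0) (trans (sumℕ≡sum {n} (λ _ → 0)) (Σℕ.sum-replicate-zero n))

sumℕ-mono : ∀ {n} {f g : Fin n → ℕ} → (∀ i → f i ≤ g i) → sumℕ f ≤ sumℕ g
sumℕ-mono {zero} f≤g = z≤n
sumℕ-mono {suc n} f≤g = NP.+-mono-≤ (f≤g F.zero) (sumℕ-mono (f≤g ∘ F.suc))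

sumℕ-+ : ∀ {n} (f g : Fin n → ℕ) → sumℕ (λ i → f i N.+ g i) ≡ sumℕ f N.+ sumℕ g
sumℕ-+ f g rewrite sumℕ≡sum f | sumℕ≡sum g | sumℕ≡sum (λ i → f i N.+ g i) = Σℕ.∑-distrib-+ f g

sumℕ-one : ∀ n → sumℕ {n} (λ _ → 1) ≡ n
sumℕ-one zero = refl
sumℕ-one (suc n) = cong suc (sumℕ-one n)

sumℕ-swap : ∀ {n m} (f : Fin n → Fin m → ℕ) →
  sumℕ (λ i → sumℕ (f i)) ≡ sumℕ (λ j → sumℕ (λ i → f i j))
sumℕ-swap {zero} {m} f = sym (sumℕ-zero {m} (λ _ → refl))
sumℕ-swap {suc n} f = trans (cong (sumℕ (f F.zero) N.+_) (sumℕ-swap (f ∘ F.suc)))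
  (sym (sumℕ-+ (f F.zero) (λ j → sumℕ (λ i → f (F.suc i) j))))

sumℕ-punchIn : ∀ {k} (t₀ : Fin (suc k)) (f : Fin (suc k) → ℕ) →
  sumℕ f ≡ f t₀ N.+ sumℕ (f ∘ punchIn t₀)
sumℕ-punchIn t₀ f rewrite sumℕ≡sum f | sumℕ≡sum (f ∘ punchIn t₀) = Σℕ.sum-remove {i = t₀} f

sumℕ-single : ∀ {n} (a : Fin n) (f : Fin n → ℕ) → (∀ j → j ≢ a → f j ≡ 0) → sumℕ f ≡ f a
sumℕ-single {suc n} a f off = begin
  sumℕ f                           ≡⟨ sumℕ-punchIn a f ⟩
  f a N.+ sumℕ (f ∘ punchIn a)     ≡⟨ cong (f a N.+_) (sumℕ-zero (λ t → off (punchIn a t) (FP.punchInᵢ≢i a t))) ⟩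
  f a N.+ 0                        ≡⟨ NP.+-identityʳ (f a) ⟩
  f a                              ∎
  where open ≡-Reasoning

sumℕ-++ : ∀ a {m} (f : Fin (a N.+ m) → ℕ) → sumℕ f ≡ sumℕ {a} (f ∘ (F._↑ˡ m)) N.+ sumℕ {m} (f ∘ (a F.↑ʳ_))
sumℕ-++ zero f = refl
sumℕ-++ (suc a) f = trans (cong (f F.zero N.+_) (sumℕ-++ a (f ∘ F.suc))) (sym (NP.+-assoc (f F.zero) _ _))

-- Linear algebra over ℚ

a*x≡0⇒x≡0 : ∀ {a x : ℚ} → a ≢ 0ℚ → a Q.* x ≡ 0ℚ → x ≡ 0ℚ
a*x≡0⇒x≡0 {a} {x} a≢0 ax≡0 = begin
  x                        ≡⟨ QP.*-identityˡ x ⟨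
  1ℚ Q.* x                 ≡⟨ cong (Q._* x) (QP.*-inverseˡ a) ⟨
  Q.1/ a Q.* a Q.* x       ≡⟨ QP.*-assoc (Q.1/ a) a x ⟩
  Q.1/ a Q.* (a Q.* x)     ≡⟨ cong (Q.1/ a Q.*_) ax≡0 ⟩
  Q.1/ a Q.* 0ℚ            ≡⟨ QP.*-zeroʳ (Q.1/ a) ⟩
  0ℚ                       ∎
  where
  open ≡-Reasoning
  instance _ = Q.≢-nonZero a≢0

IndependentOn : ∀ {n k} → List (Fin n) → (Fin k → Fin n → ℚ) → Set
IndependentOn {n} {k} S v =
  ∀ (c : Fin k → ℚ) → (∀ i → i ∈ S → sumℚ (λ t → c t Q.* v t i) ≡ 0ℚ) → ∀ t → c t ≡ 0ℚ

independentOn-drop : ∀ {n k} {s : Fin n} {S} {v : Fin k → Fin n → ℚ} →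
  (∀ t → v t s ≡ 0ℚ) → IndependentOn (s ∷ S) v → IndependentOn S v
independentOn-drop {v = v} vs≡0 ind c onS = ind c λ where
  _ (here refl) → sumℚ-zero (λ t → trans (cong (c t Q.*_) (vs≡0 t)) (QP.*-zeroʳ (c t)))
  i (there i∈S) → onS i i∈S

module Elimination {n k} (v : Fin (suc k) → Fin n → ℚ) (t₀ : Fin (suc k)) (s : Fin n)
                   (pivot≢0 : v t₀ s ≢ 0ℚ) where

  private instance _ = Q.≢-nonZero pivot≢0

  ratio : Fin k → ℚ
  ratio t = v (punchIn t₀ t) s Q.* Q.1/ (v t₀ s)

  reduced : Fin k → Fin n → ℚ
  reduced t i = v (punchIn t₀ t) i Q.+ Q.- (ratio t Q.* v t₀ i)

  reduced-vanishes : ∀ t → reduced t s ≡ 0ℚ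
  reduced-vanishes t = begin
    v′ Q.+ Q.- (v′ Q.* Q.1/ p Q.* p)     ≡⟨ cong (λ x → v′ Q.+ Q.- x) (QP.*-assoc v′ (Q.1/ p) p) ⟩
    v′ Q.+ Q.- (v′ Q.* (Q.1/ p Q.* p))   ≡⟨ cong (λ x → v′ Q.+ Q.- (v′ Q.* x)) (QP.*-inverseˡ p) ⟩
    v′ Q.+ Q.- (v′ Q.* 1ℚ)               ≡⟨ cong (λ x → v′ Q.+ Q.- x) (QP.*-identityʳ v′) ⟩
    v′ Q.+ Q.- v′                        ≡⟨ QP.+-inverseʳ v′ ⟩
    0ℚ                                   ∎
    where
    open ≡-Reasoning
    p v′ : ℚ
    p = v t₀ s
    v′ = v (punchIn t₀ t) s

  -- the combination of the v's that equals the combination c of the reduced vectors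
  lift : (Fin k → ℚ) → Fin (suc k) → ℚ
  lift c = insertAt c t₀ (Q.- sumℚ (λ t → c t Q.* ratio t))

  combination-lift : ∀ c i → sumℚ (λ t → lift c t Q.* v t i) ≡ sumℚ (λ t → c t Q.* reduced t i)
  combination-lift c i = begin
    sumℚ (λ t → lift c t Q.* v t i)
      ≡⟨ sumℚ-punchIn t₀ (λ t → lift c t Q.* v t i) ⟩
    lift c t₀ Q.* v t₀ i Q.+ sumℚ (λ t → lift c (punchIn t₀ t) Q.* v (punchIn t₀ t) i)
      ≡⟨ cong₂ (λ x y → x Q.* v t₀ i Q.+ y) (insertAt-lookup c t₀ _)
               (sumℚ-cong (λ t → cong (Q._* v (punchIn t₀ t) i) (insertAt-punchIn c t₀ _ t))) ⟩
    Q.- sumℚ (λ t → c t Q.* ratio t) Q.* v t₀ i Q.+ sumℚ (λ t → c t Q.* v (punchIn t₀ t) i)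
      ≡⟨ cong (Q._+ sumℚ (λ t → c t Q.* v (punchIn t₀ t) i)) pivot-part ⟩
    sumℚ (λ t → Q.- (c t Q.* ratio t Q.* v t₀ i)) Q.+ sumℚ (λ t → c t Q.* v (punchIn t₀ t) i)
      ≡⟨ QP.+-comm (sumℚ (λ t → Q.- (c t Q.* ratio t Q.* v t₀ i))) (sumℚ (λ t → c t Q.* v (punchIn t₀ t) i)) ⟩
    sumℚ (λ t → c t Q.* v (punchIn t₀ t) i) Q.+ sumℚ (λ t → Q.- (c t Q.* ratio t Q.* v t₀ i))
      ≡⟨ sumℚ-+ (λ t → c t Q.* v (punchIn t₀ t) i) (λ t → Q.- (c t Q.* ratio t Q.* v t₀ i)) ⟨
    sumℚ (λ t → c t Q.* v (punchIn t₀ t) i Q.+ Q.- (c t Q.* ratio t Q.* v t₀ i))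
      ≡⟨ sumℚ-cong (λ t → solve 4 (λ C V R W → C :* V :+ :- (C :* R :* W) := C :* (V :+ :- (R :* W)))
                                   refl (c t) (v (punchIn t₀ t) i) (ratio t) (v t₀ i)) ⟩
    sumℚ (λ t → c t Q.* reduced t i) ∎
    where
    open ≡-Reasoning
    pivot-part : Q.- sumℚ (λ t → c t Q.* ratio t) Q.* v t₀ i ≡ sumℚ (λ t → Q.- (c t Q.* ratio t Q.* v t₀ i))
    pivot-part = begin
      Q.- sumℚ (λ t → c t Q.* ratio t) Q.* v t₀ i     ≡⟨ QP.neg-distribˡ-* (sumℚ (λ t → c t Q.* ratio t)) (v t₀ i) ⟨
      Q.- (sumℚ (λ t → c t Q.* ratio t) Q.* v t₀ i)   ≡⟨ cong Q.-_ (sumℚ-*ʳ (v t₀ i) (λ t → c t Q.* ratio t)) ⟨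
      Q.- sumℚ (λ t → c t Q.* ratio t Q.* v t₀ i)     ≡⟨ sumℚ-neg (λ t → c t Q.* ratio t Q.* v t₀ i) ⟨
      sumℚ (λ t → Q.- (c t Q.* ratio t Q.* v t₀ i))   ∎

  reduced-independentOn : ∀ {S} → IndependentOn (s ∷ S) v → IndependentOn S reduced
  reduced-independentOn {S} ind c onS t = trans (sym (insertAt-punchIn c t₀ _ t)) (ind (lift c) onSs (punchIn t₀ t))
    where
    onSs : ∀ i → i ∈ s ∷ S → sumℚ (λ t → lift c t Q.* v t i) ≡ 0ℚ
    onSs i (here refl) = trans (combination-lift c s)
      (sumℚ-zero (λ t → trans (cong (c t Q.*_) (reduced-vanishes t)) (QP.*-zeroʳ (c t))))
    onSs i (there i∈S) = trans (combination-lift c i) (onS i i∈S)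

-- eliminate the first coordinate of S with a vector not vanishing there, or drop it if there is none
independentOn⇒≤length : ∀ {n} (S : List (Fin n)) k (v : Fin k → Fin n → ℚ) → IndependentOn S v → k ≤ length S
independentOn⇒≤length S zero v ind = z≤n
independentOn⇒≤length [] (suc k) v ind = ⊥-elim (QP.1≢0 (ind (λ _ → 1ℚ) (λ _ ()) F.zero))
independentOn⇒≤length (s ∷ S) (suc k) v ind with FP.any? (λ t → ¬? (v t s QP.≟ 0ℚ))
... | no no-pivot = NP.m≤n⇒m≤1+n (independentOn⇒≤length S (suc k) v (independentOn-drop {v = v} vs≡0 ind))
  where
  vs≡0 : ∀ t → v t s ≡ 0ℚ
  vs≡0 t with v t s QP.≟ 0ℚ
  ... | yes ≡0 = ≡0
  ... | no ≢0 = ⊥-elim (no-pivot (t , ≢0))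
... | yes (t₀ , pivot≢0) = s≤s (independentOn⇒≤length S k reduced (reduced-independentOn ind))
  where open Elimination v t₀ s pivot≢0

KernelDeterminedOn : ∀ {n} → SignedGraph n → List (Fin n) → Set
KernelDeterminedOn {n} Γ S = ∀ w → InKernel Γ w → (∀ i → i ∈ S → w i ≡ 0ℚ) → ∀ i → w i ≡ 0ℚ

combination-inKernel : ∀ {n m} (Γ : SignedGraph n) (v : Fin m → Fin n → ℚ) (c : Fin m → ℚ) →
  (∀ t → InKernel Γ (v t)) → InKernel Γ (λ j → sumℚ (λ t → c t Q.* v t j))
combination-inKernel {n} {m} Γ v c ker i = begin
  sumℚ (λ j → a j Q.* sumℚ (λ t → c t Q.* v t j))
    ≡⟨ sumℚ-cong (λ j → trans (sym (sumℚ-*ˡ (a j) (λ t → c t Q.* v t j)))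
         (sumℚ-cong (λ t → solve 3 (λ A C V → A :* (C :* V) := C :* (A :* V)) refl (a j) (c t) (v t j)))) ⟩
  sumℚ (λ j → sumℚ (λ t → c t Q.* (a j Q.* v t j)))
    ≡⟨ sumℚ-swap (λ j t → c t Q.* (a j Q.* v t j)) ⟩
  sumℚ (λ t → sumℚ (λ j → c t Q.* (a j Q.* v t j)))
    ≡⟨ sumℚ-cong (λ t → trans (sumℚ-*ˡ (c t) (λ j → a j Q.* v t j)) (trans (cong (c t Q.*_) (ker t i)) (QP.*-zeroʳ (c t)))) ⟩
  sumℚ {m} (λ _ → 0ℚ)
    ≡⟨ sumℚ-zero {m} (λ _ → refl) ⟩
  0ℚ ∎
  where
  open ≡-Reasoning
  a : Fin n → ℚ
  a j = entryℚ (σ Γ i j)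

nullity≤ : ∀ {n} (Γ : SignedGraph n) (S : List (Fin n)) → KernelDeterminedOn Γ S →
  ∀ m → KernelHasIndep Γ m → m ≤ length S
nullity≤ Γ S determined m (v , ker , ind) = independentOn⇒≤length S m v
  (λ c onS → ind c (determined _ (combination-inKernel Γ v c ker) onS))

infix 4 _∈ᵇ_
_∈ᵇ_ : ∀ {n} → Fin n → List (Fin n) → Bool
i ∈ᵇ L = does (DecMembership._∈?_ FP._≟_ i L)

∈⇒∈ᵇ : ∀ {n} {i : Fin n} {L} → i ∈ L → (i ∈ᵇ L) ≡ true
∈⇒∈ᵇ {i = i} {L} = dec-true (DecMembership._∈?_ FP._≟_ i L)

∉⇒∈ᵇ : ∀ {n} {i : Fin n} {L} → i ∉ L → (i ∈ᵇ L) ≡ false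
∉⇒∈ᵇ {i = i} {L} = dec-false (DecMembership._∈?_ FP._≟_ i L)

∈ᵇ⇒∈ : ∀ {n} {i : Fin n} {L} → (i ∈ᵇ L) ≡ true → i ∈ L
∈ᵇ⇒∈ {i = i} {L} e with DecMembership._∈?_ FP._≟_ i L
... | yes i∈L = i∈L

∈ᵇ-false⇒∉ : ∀ {n} {i : Fin n} {L} → (i ∈ᵇ L) ≡ false → i ∉ L
∈ᵇ-false⇒∉ i∉L i∈L with trans (sym i∉L) (∈⇒∈ᵇ i∈L)
... | ()

count : ∀ {n} → (Fin n → Bool) → ℕ
count P = sumℕ (λ i → if P i then 1 else 0)

countNot : ∀ {n} → (Fin n → Bool) → ℕ
countNot P = sumℕ (λ i → if P i then 0 else 1)

countNot+count : ∀ {n} (P : Fin n → Bool) → countNot P N.+ count P ≡ n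
countNot+count {n} P = trans (sym (sumℕ-+ (λ i → if P i then 0 else 1) (λ i → if P i then 1 else 0)))
  (trans (sumℕ-cong one) (sumℕ-one n))
  where
  one : ∀ i → (if P i then 0 else 1) N.+ (if P i then 1 else 0) ≡ 1
  one i with P i
  ... | true = refl
  ... | false = refl

δ : ∀ {n} → Fin n → Fin n → ℕ
δ a i = if does (i FP.≟ a) then 1 else 0

sum-δ : ∀ {n} (a : Fin n) → sumℕ (δ a) ≡ 1
sum-δ a = trans (sumℕ-single a (δ a) off) (cong (λ b → if b then 1 else 0) (dec-true (a FP.≟ a) refl))
  where
  off : ∀ j → j ≢ a → δ a j ≡ 0
  off j j≢a = cong (λ b → if b then 1 else 0) (dec-false (j FP.≟ a) j≢a)

All≢⇒∉ : ∀ {n} {v : Fin n} {L} → All (v ≢_) L → v ∉ L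
All≢⇒∉ (v≢x ∷ _) (here refl) = v≢x refl
All≢⇒∉ (_ ∷ v≢L) (there v∈L) = All≢⇒∉ v≢L v∈L

∉⇒All≢ : ∀ {n} {v : Fin n} (L : List (Fin n)) → v ∉ L → All (v ≢_) L
∉⇒All≢ [] v∉L = []
∉⇒All≢ (x ∷ L) v∉L = (v∉L ∘ here) ∷ ∉⇒All≢ L (v∉L ∘ there)

count-unique : ∀ {n} (L : List (Fin n)) → Unique L → count (_∈ᵇ L) ≡ length L
count-unique {n} [] _ = sumℕ-zero {n} (λ _ → refl)
count-unique (v ∷ L) (v∉L ∷ uL) = begin
  count (_∈ᵇ v ∷ L)               ≡⟨ sumℕ-cong split ⟩
  sumℕ (λ i → δ v i N.+ (if i ∈ᵇ L then 1 else 0))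
                                  ≡⟨ sumℕ-+ (δ v) (λ i → if i ∈ᵇ L then 1 else 0) ⟩
  sumℕ (δ v) N.+ count (_∈ᵇ L)    ≡⟨ cong₂ N._+_ (sum-δ v) (count-unique L uL) ⟩
  suc (length L)                  ∎
  where
  open ≡-Reasoning
  split : ∀ i → (if i ∈ᵇ v ∷ L then 1 else 0) ≡ δ v i N.+ (if i ∈ᵇ L then 1 else 0)
  split i with i FP.≟ v
  ... | yes refl = cong (λ b → 1 N.+ (if b then 1 else 0)) (sym (∉⇒∈ᵇ (All≢⇒∉ v∉L)))
  ... | no _ = refl

unique-length≤sum : ∀ {n} (L : List (Fin n)) (f : Fin n → ℕ) → Unique L → (∀ i → i ∈ L → 1 ≤ f i) →
  length L ≤ sumℕ f
unique-length≤sum L f uL pos = subst (_≤ sumℕ f) (count-unique L uL) (sumℕ-mono bound)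
  where
  bound : ∀ i → (if i ∈ᵇ L then 1 else 0) ≤ f i
  bound i with i ∈ᵇ L in eq
  ... | true = pos i (∈ᵇ⇒∈ eq)
  ... | false = z≤n

outside : ∀ {n} → (Fin n → Bool) → List (Fin n)
outside {zero} P = []
outside {suc n} P = (if P F.zero then (λ xs → xs) else (F.zero ∷_)) (L.map F.suc (outside (P ∘ F.suc)))

length-outside : ∀ {n} (P : Fin n → Bool) → length (outside P) ≡ countNot P
length-outside {zero} P = refl
length-outside {suc n} P with P F.zero
... | true = trans (LP.length-map F.suc (outside (P ∘ F.suc))) (length-outside (P ∘ F.suc))
... | false = cong suc (trans (LP.length-map F.suc (outside (P ∘ F.suc))) (length-outside (P ∘ F.suc)))

∈-outside : ∀ {n} (P : Fin n → Bool) i → P i ≡ false → i ∈ outside P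
∈-outside {suc n} P F.zero Pi≡false rewrite Pi≡false = here refl
∈-outside {suc n} P (F.suc i) Pi≡false with P F.zero
... | true = ∈-map⁺ F.suc (∈-outside (P ∘ F.suc) i Pi≡false)
... | false = there (∈-map⁺ F.suc (∈-outside (P ∘ F.suc) i Pi≡false))

-- Triangular certificates

cols : ∀ {n} → List (Fin n × Fin n) → List (Fin n)
cols = L.map proj₂

-- the submatrix on the rows and columns of the pairs is triangular with nonzero diagonal
Triangular : ∀ {n} → SignedGraph n → List (Fin n × Fin n) → Set
Triangular Γ [] = ⊤
Triangular Γ ((r , c) ∷ P) = Adj Γ r c × All (λ c′ → σ Γ r c′ ≡ none) (cols P) × Triangular Γ P

entryℚ-nonzero : ∀ {e} → e ≢ none → entryℚ e ≢ 0ℚ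
entryℚ-nonzero {none} e≢none = ⊥-elim (e≢none refl)
entryℚ-nonzero {plus} _ = λ ()
entryℚ-nonzero {minus} _ = λ ()

triangular-determined : ∀ {n} (Γ : SignedGraph n) P → Triangular Γ P →
  ∀ w → InKernel Γ w → (∀ i → i ∉ cols P → w i ≡ 0ℚ) → ∀ i → w i ≡ 0ℚ
triangular-determined Γ [] _ w ker out i = out i (λ ())
triangular-determined Γ ((r , c) ∷ P) (r~c , row-r , tri) w ker out =
  triangular-determined Γ P tri w ker out′
  where
  off-c : ∀ j → j ≢ c → entryℚ (σ Γ r j) Q.* w j ≡ 0ℚ
  off-c j j≢c with DecMembership._∈?_ FP._≟_ j (cols P)
  ... | yes j∈P = trans (cong (λ e → entryℚ e Q.* w j) (All.lookup row-r j∈P)) (QP.*-zeroˡ (w j))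
  ... | no j∉P = trans (cong (entryℚ (σ Γ r j) Q.*_) (out j j∉c∷P)) (QP.*-zeroʳ (entryℚ (σ Γ r j)))
    where
    j∉c∷P : j ∉ c ∷ cols P
    j∉c∷P (here j≡c) = j≢c j≡c
    j∉c∷P (there j∈P) = j∉P j∈P
  wc≡0 : w c ≡ 0ℚ
  wc≡0 = a*x≡0⇒x≡0 (entryℚ-nonzero r~c)
    (trans (sym (sumℚ-single c (λ j → entryℚ (σ Γ r j) Q.* w j) off-c)) (ker r))
  out′ : ∀ i → i ∉ cols P → w i ≡ 0ℚ
  out′ i i∉P with i FP.≟ c
  ... | yes refl = wc≡0
  ... | no i≢c = out i λ where
    (here i≡c) → i≢c i≡c
    (there i∈P) → i∉P i∈P

triangular-nullity : ∀ {n} (Γ : SignedGraph n) P → Triangular Γ P →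
  (C : List (Fin n)) → Unique C → (∀ c → c ∈ C → c ∈ cols P) →
  ∀ m → KernelHasIndep Γ m → m N.+ length C ≤ n
triangular-nullity {n} Γ P tri C uC C⊆P m indep =
  subst (m N.+ length C ≤_) total (NP.+-mono-≤ (nullity≤ Γ S determined m indep) C≤P)
  where
  S : List (Fin n)
  S = outside (_∈ᵇ cols P)
  determined : KernelDeterminedOn Γ S
  determined w ker onS = triangular-determined Γ P tri w ker
    (λ i i∉P → onS i (∈-outside (_∈ᵇ cols P) i (∉⇒∈ᵇ i∉P)))
  C≤P : length C ≤ count (_∈ᵇ cols P)
  C≤P = unique-length≤sum C _ uC (λ i i∈C → NP.≤-reflexive (sym (cong (λ b → if b then 1 else 0) (∈⇒∈ᵇ (C⊆P i i∈C)))))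
  total : length S N.+ count (_∈ᵇ cols P) ≡ n
  total = trans (cong (N._+ count (_∈ᵇ cols P)) (length-outside (_∈ᵇ cols P))) (countNot+count (_∈ᵇ cols P))

module _ {m n : ℕ} where

  <ᵇ-true : m < n → (m N.<ᵇ n) ≡ true
  <ᵇ-true = dec-true (m N.<? n)

  <ᵇ-false : ¬ m < n → (m N.<ᵇ n) ≡ false
  <ᵇ-false = dec-false (m N.<? n)

  ≡ᵇ-true : m ≡ n → (m N.≡ᵇ n) ≡ true
  ≡ᵇ-true = dec-true (m N.≟ n)

  ≡ᵇ-false : m ≢ n → (m N.≡ᵇ n) ≡ false
  ≡ᵇ-false = dec-false (m N.≟ n)

  <ᵇ⇒< : (m N.<ᵇ n) ≡ true → m < n
  <ᵇ⇒< e = NP.<ᵇ⇒< m n (subst T (sym e) tt)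

  <ᵇ⇒≮ : (m N.<ᵇ n) ≡ false → ¬ m < n
  <ᵇ⇒≮ e m<n = subst T e (NP.<⇒<ᵇ m<n)

  ≡ᵇ⇒≡ : (m N.≡ᵇ n) ≡ true → m ≡ n
  ≡ᵇ⇒≡ e = NP.≡ᵇ⇒≡ m n (subst T (sym e) tt)

module _ {n : ℕ} (Γ : SignedGraph n) where

  arc : Fin n → Fin n → ℕ
  arc i j = if (toℕ i N.<ᵇ toℕ j) ∧ isEdgeᵇ (σ Γ i j) then 1 else 0

  adjℕ : Fin n → Fin n → ℕ
  adjℕ i j = if isEdgeᵇ (σ Γ i j) then 1 else 0

  edgesIn : (Fin n → Bool) → ℕ
  edgesIn P = sumℕ (λ i → sumℕ (λ j → if P i ∧ P j then arc i j else 0))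

  degIn : (Fin n → Bool) → Fin n → ℕ
  degIn P v = sumℕ (λ j → if P j then adjℕ v j else 0)

  arc-pair : ∀ i j → i ≢ j → arc i j N.+ arc j i ≡ adjℕ i j
  arc-pair i j i≢j rewrite SignedGraph.sym Γ j i with toℕ i N.<ᵇ toℕ j in i<j | toℕ j N.<ᵇ toℕ i in j<i
  ... | true | true = ⊥-elim (NP.<-asym (<ᵇ⇒< {toℕ i} {toℕ j} i<j) (<ᵇ⇒< j<i))
  ... | true | false = NP.+-identityʳ _
  ... | false | true = refl
  ... | false | false with NP.<-cmp (toℕ i) (toℕ j)
  ...   | tri< lt _ _ = ⊥-elim (<ᵇ⇒≮ i<j lt)
  ...   | tri≈ _ i≡j _ = ⊥-elim (i≢j (FP.toℕ-injective i≡j))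
  ...   | tri> _ _ gt = ⊥-elim (<ᵇ⇒≮ j<i gt)

  arc-loop : ∀ v → arc v v ≡ 0
  arc-loop v rewrite loopless Γ v with toℕ v N.<ᵇ toℕ v
  ... | true = refl
  ... | false = refl

  edgesIn-cong : ∀ {P Q : Fin n → Bool} → P ≗ Q → edgesIn P ≡ edgesIn Q
  edgesIn-cong P≗Q = sumℕ-cong (λ i → sumℕ-cong (λ j → cong₂ (λ a b → if a ∧ b then arc i j else 0) (P≗Q i) (P≗Q j)))

  adj⇒adjℕ : ∀ {a b} → Adj Γ a b → adjℕ a b ≡ 1
  adj⇒adjℕ {a} {b} a~b with σ Γ a b
  ... | none = ⊥-elim (a~b refl)
  ... | plus = refl
  ... | minus = refl

  -- an edge inside P ∪ {v} lies inside P, or is an arc leaving v, or an arc entering v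
  private
    split-insert : ∀ (P : Fin n → Bool) v → P v ≡ false → ∀ i j →
      (if (does (i FP.≟ v) ∨ P i) ∧ (does (j FP.≟ v) ∨ P j) then arc i j else 0) ≡
      (if P i ∧ P j then arc i j else 0) N.+
        ((if does (i FP.≟ v) then (if P j then arc i j else 0) else 0) N.+
         (if does (j FP.≟ v) then (if P i then arc i j else 0) else 0))
    split-insert P v Pv i j with i FP.≟ v | j FP.≟ v
    ... | yes refl | yes refl rewrite Pv = arc-loop i
    ... | yes refl | no _ rewrite Pv with P j
    ...   | true = sym (NP.+-identityʳ _)
    ...   | false = refl
    split-insert P v Pv i j | no _ | yes refl rewrite Pv | BP.∧-identityʳ (P i) with P i
    ...   | true = refl
    ...   | false = refl
    split-insert P v Pv i j | no _ | no _ = sym (NP.+-identityʳ _)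

    sum-at : ∀ v (g : Fin n → Fin n → ℕ) →
      sumℕ (λ i → sumℕ (λ j → if does (i FP.≟ v) then g i j else 0)) ≡ sumℕ (g v)
    sum-at v g = trans (sumℕ-single v _ off) (sumℕ-cong (λ j → cong (λ b → if b then g v j else 0) (dec-true (v FP.≟ v) refl)))
      where
      off : ∀ i → i ≢ v → sumℕ (λ j → if does (i FP.≟ v) then g i j else 0) ≡ 0
      off i i≢v rewrite dec-false (i FP.≟ v) i≢v = sumℕ-zero {n} (λ _ → refl)

  edgesIn-insert : ∀ (P : Fin n → Bool) v → P v ≡ false →
    edgesIn (λ i → does (i FP.≟ v) ∨ P i) ≡ edgesIn P N.+ degIn P v
  edgesIn-insert P v Pv = begin
    edgesIn (λ i → does (i FP.≟ v) ∨ P i)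
      ≡⟨ sumℕ-cong (λ i → trans (sumℕ-cong (split-insert P v Pv i))
                              (trans (sumℕ-+ (inside i) (λ j → out i j N.+ into i j)) (cong (sumℕ (inside i) N.+_) (sumℕ-+ (out i) (into i))))) ⟩
    sumℕ (λ i → sumℕ (inside i) N.+ (sumℕ (out i) N.+ sumℕ (into i)))
      ≡⟨ sumℕ-+ (λ i → sumℕ (inside i)) _ ⟩
    edgesIn P N.+ sumℕ (λ i → sumℕ (out i) N.+ sumℕ (into i))
      ≡⟨ cong (edgesIn P N.+_) (sumℕ-+ (λ i → sumℕ (out i)) (λ i → sumℕ (into i))) ⟩
    edgesIn P N.+ (sumℕ (λ i → sumℕ (out i)) N.+ sumℕ (λ i → sumℕ (into i)))
      ≡⟨ cong (edgesIn P N.+_) (cong₂ N._+_ (sum-at v (λ i j → if P j then arc i j else 0))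
                                             (trans (sumℕ-swap into) (sum-at v (λ j i → if P i then arc i j else 0)))) ⟩
    edgesIn P N.+ (sumℕ (λ j → if P j then arc v j else 0) N.+ sumℕ (λ i → if P i then arc i v else 0))
      ≡⟨ cong (edgesIn P N.+_) (trans (sym (sumℕ-+ (λ j → if P j then arc v j else 0) (λ i → if P i then arc i v else 0)))
                                      (sumℕ-cong both-ways)) ⟩
    edgesIn P N.+ degIn P v ∎
    where
    open ≡-Reasoning
    inside out into : Fin n → Fin n → ℕ
    inside i j = if P i ∧ P j then arc i j else 0
    out i j = if does (i FP.≟ v) then (if P j then arc i j else 0) else 0
    into i j = if does (j FP.≟ v) then (if P i then arc i j else 0) else 0
    both-ways : ∀ j → (if P j then arc v j else 0) N.+ (if P j then arc j v else 0) ≡ (if P j then adjℕ v j else 0)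
    both-ways j with j FP.≟ v
    ... | yes refl rewrite Pv = refl
    ... | no j≢v with P j
    ...   | true = arc-pair v j (j≢v ∘ sym)
    ...   | false = refl

-- Connected graphs

Adj-sym : ∀ {n} (Γ : SignedGraph n) {a b} → Adj Γ a b → Adj Γ b a
Adj-sym Γ {a} {b} a~b b~a≡none = a~b (trans (SignedGraph.sym Γ a b) b~a≡none)

boundary-edge : ∀ {n} (Γ : SignedGraph n) (L : List (Fin n)) x xs y →
  Consec Γ (x ∷ xs ++ [ y ]) → x ∈ L → y ∉ L →
  Σ (Fin n) λ a → Σ (Fin n) λ b → a ∈ L × b ∉ L × Adj Γ a b
boundary-edge Γ L x [] y (x~y , _) x∈L y∉L = x , y , x∈L , y∉L , x~y
boundary-edge Γ L x (z ∷ zs) y (x~z , walk) x∈L y∉L with DecMembership._∈?_ FP._≟_ z L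
... | yes z∈L = boundary-edge Γ L z zs y walk z∈L y∉L
... | no z∉L = x , z , x∈L , z∉L , x~z

countNot-∷ : ∀ {n} (L : List (Fin n)) b → b ∉ L → countNot (_∈ᵇ L) ≡ suc (countNot (_∈ᵇ b ∷ L))
countNot-∷ L b b∉L = trans (sumℕ-cong split) (trans (sumℕ-+ (δ b) _) (cong (N._+ countNot (_∈ᵇ b ∷ L)) (sum-δ b)))
  where
  split : ∀ i → (if i ∈ᵇ L then 0 else 1) ≡ δ b i N.+ (if i ∈ᵇ b ∷ L then 0 else 1)
  split i with i FP.≟ b
  ... | yes refl rewrite ∉⇒∈ᵇ b∉L = refl
  ... | no _ = refl

length≤degIn : ∀ {n} (Γ : SignedGraph n) (P : Fin n → Bool) v (B : List (Fin n)) → Unique B →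
  All (λ b → P b ≡ true × Adj Γ v b) B → length B ≤ degIn Γ P v
length≤degIn Γ P v B uB nbrs = unique-length≤sum B _ uB one
  where
  one : ∀ i → i ∈ B → 1 ≤ (if P i then adjℕ Γ v i else 0)
  one i i∈B with All.lookup nbrs i∈B
  ... | Pi , v~i rewrite Pi | adj⇒adjℕ Γ v~i = s≤s z≤n

module _ {n : ℕ} (Γ : SignedGraph n) where

  edgesIn-∷ : ∀ L {a b} → a ∈ L → b ∉ L → Adj Γ a b →
    edgesIn Γ (_∈ᵇ L) N.+ countNot (_∈ᵇ L) ≤ edgesIn Γ (_∈ᵇ b ∷ L) N.+ countNot (_∈ᵇ b ∷ L)
  edgesIn-∷ L {a} {b} a∈L b∉L a~b = begin
    E N.+ countNot (_∈ᵇ L)              ≡⟨ cong (E N.+_) (countNot-∷ L b b∉L) ⟩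
    E N.+ suc c                         ≡⟨ NP.+-suc E c ⟩
    suc E N.+ c                         ≡⟨ cong (N._+ c) (NP.+-comm 1 E) ⟩
    E N.+ 1 N.+ c                       ≤⟨ NP.+-monoˡ-≤ c (NP.+-monoʳ-≤ E one-edge) ⟩
    E N.+ degIn Γ (_∈ᵇ L) b N.+ c       ≡⟨ cong (N._+ c) (edgesIn-insert Γ (_∈ᵇ L) b (∉⇒∈ᵇ b∉L)) ⟨
    edgesIn Γ (_∈ᵇ b ∷ L) N.+ c         ∎
    where
    open NP.≤-Reasoning
    E c : ℕ
    E = edgesIn Γ (_∈ᵇ L)
    c = countNot (_∈ᵇ b ∷ L)
    one-edge : 1 ≤ degIn Γ (_∈ᵇ L) b
    one-edge = length≤degIn Γ (_∈ᵇ L) b [ a ] ([] ∷ []) ((∈⇒∈ᵇ a∈L , Adj-sym Γ a~b) ∷ [])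

  edgesIn-everything : ∀ L → (∀ i → i ∈ L) → edgesIn Γ (_∈ᵇ L) N.+ countNot (_∈ᵇ L) ≡ edgeCount Γ
  edgesIn-everything L all-in = trans (cong₂ N._+_ (edgesIn-cong Γ inside) (sumℕ-zero (λ i → cong (λ b → if b then 0 else 1) (inside i))))
    (NP.+-identityʳ _)
    where
    inside : ∀ i → (i ∈ᵇ L) ≡ true
    inside i = ∈⇒∈ᵇ (all-in i)

  -- induction on the vertices outside L: one of them is adjacent to L and brings along an edge
  edgesIn+outside≤edgeCount : Connected Γ → ∀ {u} (L : List (Fin n)) →
    u ∈ L → Unique L → edgesIn Γ (_∈ᵇ L) N.+ countNot (_∈ᵇ L) ≤ edgeCount Γ
  edgesIn+outside≤edgeCount connected {u} L u∈L uL = go _ L u∈L uL refl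
    where
    go : ∀ k L → u ∈ L → Unique L → countNot (_∈ᵇ L) ≡ k → edgesIn Γ (_∈ᵇ L) N.+ countNot (_∈ᵇ L) ≤ edgeCount Γ
    go k L u∈L uL outside≡k with FP.any? (λ i → ¬? (DecMembership._∈?_ FP._≟_ i L))
    ... | no all-in = NP.≤-reflexive (edgesIn-everything L
                        (λ i → decidable-stable (DecMembership._∈?_ FP._≟_ i L) (λ i∉L → all-in (i , i∉L))))
    ... | yes (y , y∉L) with boundary-edge Γ L u (proj₁ (connected u y)) y (proj₂ (connected u y)) u∈L y∉L | k
    ...   | a , b , a∈L , b∉L , a~b | zero = ⊥-elim (NP.0≢1+n (trans (sym outside≡k) (countNot-∷ L b b∉L)))
    ...   | a , b , a∈L , b∉L , a~b | suc k′ = NP.≤-trans (edgesIn-∷ L a∈L b∉L a~b)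
            (go k′ (b ∷ L) (there u∈L) (∉⇒All≢ L b∉L ∷ uL) (NP.suc-injective (trans (sym (countNot-∷ L b b∉L)) outside≡k)))

-- Layouts

-- a vertex order in which every vertex lists some earlier vertices declared adjacent to it
Layout : ℕ → Set
Layout n = List (Fin n × List (Fin n))

vertices : ∀ {n} → Layout n → List (Fin n)
vertices = L.map proj₁

declared : ∀ {n} → Layout n → ℕ
declared [] = 0
declared ((v , B) ∷ R) = length B N.+ declared R

-- P lists the vertices placed before R
Sound : ∀ {n} → SignedGraph n → List (Fin n) → Layout n → Set
Sound Γ P [] = ⊤
Sound Γ P ((v , B) ∷ R) = Unique B × All (λ b → b ∈ P × Adj Γ v b) B × Sound Γ (P ++ [ v ]) R

Complete : ∀ {n} → SignedGraph n → List (Fin n) → Layout n → Set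
Complete Γ P [] = ⊤
Complete Γ P ((v , B) ∷ R) = (∀ a → a ∈ P → Adj Γ v a → a ∈ B) × Complete Γ (P ++ [ v ]) R

unique-++-disjoint : ∀ {n} (A : List (Fin n)) {B} → Unique (A ++ B) → ∀ {x y} → x ∈ A → y ∈ B → x ≢ y
unique-++-disjoint (a ∷ A) (a∉ ∷ u) (here refl) y∈B = All.lookup a∉ (∈-++⁺ʳ A y∈B)
unique-++-disjoint (a ∷ A) (_ ∷ u) (there x∈A) y∈B = unique-++-disjoint A u x∈A y∈B

unique-++ʳ : ∀ {n} (A : List (Fin n)) {B} → Unique (A ++ B) → Unique B
unique-++ʳ [] u = u
unique-++ʳ (a ∷ A) (_ ∷ u) = unique-++ʳ A u

unique-++ˡ : ∀ {n} (A : List (Fin n)) {B} → Unique (A ++ B) → Unique A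
unique-++ˡ [] u = []
unique-++ˡ (a ∷ A) (a∉ ∷ u) = All.tabulate (λ x∈A → All.lookup a∉ (∈-++⁺ˡ x∈A)) ∷ unique-++ˡ A u

module _ {n : ℕ} (Γ : SignedGraph n) where

  edgesIn-snoc : ∀ (P : List (Fin n)) v → v ∉ P →
    edgesIn Γ (_∈ᵇ P ++ [ v ]) ≡ edgesIn Γ (_∈ᵇ P) N.+ degIn Γ (_∈ᵇ P) v
  edgesIn-snoc P v v∉P = trans (edgesIn-cong Γ reorder) (edgesIn-insert Γ (_∈ᵇ P) v (∉⇒∈ᵇ v∉P))
    where
    ∈ᵇ-++ : ∀ (P Q : List (Fin n)) i → (i ∈ᵇ P ++ Q) ≡ ((i ∈ᵇ P) ∨ (i ∈ᵇ Q))
    ∈ᵇ-++ [] Q i = refl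
    ∈ᵇ-++ (x ∷ P) Q i rewrite ∈ᵇ-++ P Q i = sym (BP.∨-assoc (does (i FP.≟ x)) (i ∈ᵇ P) (i ∈ᵇ Q))
    reorder : ∀ i → (i ∈ᵇ P ++ [ v ]) ≡ (does (i FP.≟ v) ∨ (i ∈ᵇ P))
    reorder i rewrite ∈ᵇ-++ P [ v ] i = trans (cong ((i ∈ᵇ P) ∨_) (BP.∨-identityʳ _)) (BP.∨-comm (i ∈ᵇ P) _)

  declared≤degIn : ∀ (P : List (Fin n)) v B → Unique B → All (λ b → b ∈ P × Adj Γ v b) B → length B ≤ degIn Γ (_∈ᵇ P) v
  declared≤degIn P v B uB nbrs = length≤degIn Γ (_∈ᵇ P) v B uB (All.map (λ (b∈P , v~b) → ∈⇒∈ᵇ b∈P , v~b) nbrs)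

  private
    snoc-++ : ∀ (P : List (Fin n)) v R → (P ++ [ v ]) ++ R ≡ P ++ v ∷ R
    snoc-++ P v R = LP.++-assoc P [ v ] R

    unique-snoc : ∀ (P : List (Fin n)) v R → Unique (P ++ v ∷ R) → Unique ((P ++ [ v ]) ++ R)
    unique-snoc P v R = subst Unique (sym (snoc-++ P v R))

    not-before : ∀ (P : List (Fin n)) v R → Unique (P ++ v ∷ R) → v ∉ P
    not-before P v R u v∈P = unique-++-disjoint P u v∈P (here refl) refl

  sound⇒declared≤edgesIn : ∀ P R → Unique (P ++ vertices R) → Sound Γ P R →
    edgesIn Γ (_∈ᵇ P) N.+ declared R ≤ edgesIn Γ (_∈ᵇ P ++ vertices R)
  sound⇒declared≤edgesIn P [] _ _ = NP.≤-reflexive (trans (NP.+-identityʳ _) (cong (λ Q → edgesIn Γ (_∈ᵇ Q)) (sym (LP.++-identityʳ P))))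
  sound⇒declared≤edgesIn P ((v , B) ∷ R) u (uB , nbrs , sound) = begin
    EP N.+ (length B N.+ declared R)             ≡⟨ NP.+-assoc EP (length B) (declared R) ⟨
    EP N.+ length B N.+ declared R               ≤⟨ NP.+-monoˡ-≤ (declared R) (NP.+-monoʳ-≤ EP (declared≤degIn P v B uB nbrs)) ⟩
    EP N.+ degIn Γ (_∈ᵇ P) v N.+ declared R      ≡⟨ cong (N._+ declared R) (edgesIn-snoc P v (not-before P v _ u)) ⟨
    edgesIn Γ (_∈ᵇ P ++ [ v ]) N.+ declared R    ≤⟨ sound⇒declared≤edgesIn (P ++ [ v ]) R (unique-snoc P v _ u) sound ⟩
    edgesIn Γ (_∈ᵇ (P ++ [ v ]) ++ vertices R)   ≡⟨ cong (λ Q → edgesIn Γ (_∈ᵇ Q)) (snoc-++ P v (vertices R)) ⟩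
    edgesIn Γ (_∈ᵇ P ++ v ∷ vertices R)          ∎
    where
    open NP.≤-Reasoning
    EP : ℕ
    EP = edgesIn Γ (_∈ᵇ P)

  tight⇒complete : ∀ P R → Unique (P ++ vertices R) → Sound Γ P R →
    edgesIn Γ (_∈ᵇ P ++ vertices R) ≤ edgesIn Γ (_∈ᵇ P) N.+ declared R → Complete Γ P R
  tight⇒complete P [] _ _ _ = tt
  tight⇒complete P ((v , B) ∷ R) u (uB , nbrs , sound) tight =
    all-declared , tight⇒complete (P ++ [ v ]) R u′ sound tight′
    where
    u′ : Unique ((P ++ [ v ]) ++ vertices R)
    u′ = unique-snoc P v _ u
    EP Ev E d : ℕ
    EP = edgesIn Γ (_∈ᵇ P)
    Ev = edgesIn Γ (_∈ᵇ P ++ [ v ])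
    E = edgesIn Γ (_∈ᵇ (P ++ [ v ]) ++ vertices R)
    d = degIn Γ (_∈ᵇ P) v
    Ev≡ : Ev ≡ EP N.+ d
    Ev≡ = edgesIn-snoc P v (not-before P v _ u)
    E≤ : E ≤ EP N.+ length B N.+ declared R
    E≤ = subst₂ _≤_ (cong (λ Q → edgesIn Γ (_∈ᵇ Q)) (sym (snoc-++ P v (vertices R))))
                    (sym (NP.+-assoc EP (length B) (declared R))) tight
    d≤B : d ≤ length B
    d≤B = NP.+-cancelˡ-≤ EP d (length B) (NP.+-cancelʳ-≤ (declared R) (EP N.+ d) (EP N.+ length B) (begin
      EP N.+ d N.+ declared R       ≡⟨ cong (N._+ declared R) Ev≡ ⟨
      Ev N.+ declared R             ≤⟨ sound⇒declared≤edgesIn (P ++ [ v ]) R u′ sound ⟩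
      E                             ≤⟨ E≤ ⟩
      EP N.+ length B N.+ declared R ∎))
      where open NP.≤-Reasoning
    tight′ : E ≤ Ev N.+ declared R
    tight′ = begin
      E                              ≤⟨ E≤ ⟩
      EP N.+ length B N.+ declared R ≤⟨ NP.+-monoˡ-≤ (declared R) (NP.+-monoʳ-≤ EP (declared≤degIn P v B uB nbrs)) ⟩
      EP N.+ d N.+ declared R        ≡⟨ cong (N._+ declared R) Ev≡ ⟨
      Ev N.+ declared R              ∎
      where open NP.≤-Reasoning
    all-declared : ∀ a → a ∈ P → Adj Γ v a → a ∈ B
    all-declared a a∈P v~a with DecMembership._∈?_ FP._≟_ a B
    ... | yes a∈B = a∈B
    ... | no a∉B = ⊥-elim (NP.<⇒≱ (declared≤degIn P v (a ∷ B) (∉⇒All≢ B a∉B ∷ uB) ((a∈P , v~a) ∷ nbrs)) d≤B)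

  -- connectivity leaves room for only |R| + 1 edges among the vertices of R
  bicyclic-complete : Bicyclic Γ → ∀ {u} R → u ∈ vertices R → Unique (vertices R) →
    Sound Γ [] R → declared R ≡ suc (length R) → Complete Γ [] R
  bicyclic-complete (connected , edges) R u∈R uR sound declared≡ = tight⇒complete [] R uR sound
    (NP.+-cancelʳ-≤ (countNot (_∈ᵇ V)) _ _ (begin
      edgesIn Γ (_∈ᵇ V) N.+ countNot (_∈ᵇ V)             ≤⟨ edgesIn+outside≤edgeCount Γ connected V u∈R uR ⟩
      edgeCount Γ                                        ≡⟨ edges ⟩
      suc n                                              ≡⟨ cong suc (countNot+count (_∈ᵇ V)) ⟨
      suc (countNot (_∈ᵇ V) N.+ count (_∈ᵇ V))           ≡⟨ cong (λ c → suc (countNot (_∈ᵇ V) N.+ c)) (count-unique V uR) ⟩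
      suc (countNot (_∈ᵇ V) N.+ length V)                ≡⟨ cong suc (NP.+-comm (countNot (_∈ᵇ V)) (length V)) ⟩
      suc (length V) N.+ countNot (_∈ᵇ V)                ≡⟨ cong (λ l → suc l N.+ countNot (_∈ᵇ V)) (LP.length-map proj₁ R) ⟩
      suc (length R) N.+ countNot (_∈ᵇ V)                ≡⟨ cong (N._+ countNot (_∈ᵇ V)) declared≡ ⟨
      declared R N.+ countNot (_∈ᵇ V)                    ≡⟨ cong (λ e → e N.+ declared R N.+ countNot (_∈ᵇ V)) nothing-inside-∅ ⟨
      edgesIn Γ (_∈ᵇ []) N.+ declared R N.+ countNot (_∈ᵇ V) ∎))
    where
    open NP.≤-Reasoning
    V : List (Fin n)
    V = vertices R
    nothing-inside-∅ : edgesIn Γ (_∈ᵇ []) ≡ 0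
    nothing-inside-∅ = sumℕ-zero {n} (λ i → sumℕ-zero {n} (λ j → refl))

lastOf : ∀ {n} → Fin n → List (Fin n) → Fin n
lastOf p [] = p
lastOf p (v ∷ vs) = lastOf v vs

-- the vertices vs following p on a cycle through f, the last one closing the cycle at f
cycleRest : ∀ {n} → Fin n → Fin n → List (Fin n) → Layout n
cycleRest f p [] = []
cycleRest f p (v ∷ []) = (v , p ∷ f ∷ []) ∷ []
cycleRest f p (v ∷ w ∷ vs) = (v , [ p ]) ∷ cycleRest f v (w ∷ vs)

pathRest : ∀ {n} → Fin n → List (Fin n) → Layout n
pathRest p [] = []
pathRest p (w ∷ ws) = (w , [ p ]) ∷ pathRest w ws

module _ {n : ℕ} where

  vertices-cycleRest : ∀ (f p : Fin n) vs → vertices (cycleRest f p vs) ≡ vs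
  vertices-cycleRest f p [] = refl
  vertices-cycleRest f p (v ∷ []) = refl
  vertices-cycleRest f p (v ∷ w ∷ vs) = cong (v ∷_) (vertices-cycleRest f v (w ∷ vs))

  vertices-pathRest : ∀ (p : Fin n) ws → vertices (pathRest p ws) ≡ ws
  vertices-pathRest p [] = refl
  vertices-pathRest p (w ∷ ws) = cong (w ∷_) (vertices-pathRest w ws)

  declared-cycleRest : ∀ (f p v : Fin n) vs → declared (cycleRest f p (v ∷ vs)) ≡ suc (length (cycleRest f p (v ∷ vs)))
  declared-cycleRest f p v [] = refl
  declared-cycleRest f p v (w ∷ vs) = cong suc (declared-cycleRest f v w vs)

  declared-pathRest : ∀ (p : Fin n) ws → declared (pathRest p ws) ≡ length (pathRest p ws)
  declared-pathRest p [] = refl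
  declared-pathRest p (w ∷ ws) = cong suc (declared-pathRest w ws)

  declared-++ : ∀ (R₁ R₂ : Layout n) → declared (R₁ ++ R₂) ≡ declared R₁ N.+ declared R₂
  declared-++ [] R₂ = refl
  declared-++ ((v , B) ∷ R₁) R₂ = trans (cong (length B N.+_) (declared-++ R₁ R₂)) (sym (NP.+-assoc (length B) (declared R₁) (declared R₂)))

  lastOf-∈ : ∀ (P : List (Fin n)) p ws → p ∈ P → lastOf p ws ∈ P ++ ws
  lastOf-∈ P p [] p∈P = ∈-++⁺ˡ p∈P
  lastOf-∈ P p (w ∷ ws) p∈P = subst (lastOf w ws ∈_) (LP.++-assoc P [ w ] ws) (lastOf-∈ (P ++ [ w ]) w ws (∈-++⁺ʳ P (here refl)))

∈-single : ∀ {n} {a b : Fin n} → a ∈ [ b ] → a ≡ b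
∈-single (here a≡b) = a≡b

module _ {n : ℕ} (Γ : SignedGraph n) where

  sound-++ : ∀ P R₁ R₂ → Sound Γ P R₁ → Sound Γ (P ++ vertices R₁) R₂ → Sound Γ P (R₁ ++ R₂)
  sound-++ P [] R₂ _ s₂ = subst (λ Q → Sound Γ Q R₂) (LP.++-identityʳ P) s₂
  sound-++ P ((v , B) ∷ R₁) R₂ (uB , nbrs , s₁) s₂ =
    uB , nbrs , sound-++ (P ++ [ v ]) R₁ R₂ s₁ (subst (λ Q → Sound Γ Q R₂) (sym (LP.++-assoc P [ v ] (vertices R₁))) s₂)

  complete-++ : ∀ P R₁ R₂ → Complete Γ P (R₁ ++ R₂) → Complete Γ P R₁ × Complete Γ (P ++ vertices R₁) R₂
  complete-++ P [] R₂ c = tt , subst (λ Q → Complete Γ Q R₂) (sym (LP.++-identityʳ P)) c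
  complete-++ P ((v , B) ∷ R₁) R₂ (c , cs) with complete-++ (P ++ [ v ]) R₁ R₂ cs
  ... | c₁ , c₂ = (c , c₁) , subst (λ Q → Complete Γ Q R₂) (LP.++-assoc P [ v ] (vertices R₁)) c₂

  cycleRest-sound : ∀ P f p vs → f ∈ P → p ∈ P → p ≢ f → f ∉ vs → Consec Γ (p ∷ vs) →
    Adj Γ (lastOf p vs) f → Sound Γ P (cycleRest f p vs)
  cycleRest-sound P f p [] _ _ _ _ _ _ = tt
  cycleRest-sound P f p (v ∷ []) f∈P p∈P p≢f _ (p~v , _) v~f =
    ((p≢f ∷ []) ∷ [] ∷ []) , ((p∈P , Adj-sym Γ p~v) ∷ (f∈P , v~f) ∷ []) , tt
  cycleRest-sound P f p (v ∷ w ∷ vs) f∈P p∈P p≢f f∉vs (p~v , walk) closes =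
    ([] ∷ []) , ((p∈P , Adj-sym Γ p~v) ∷ []) ,
    cycleRest-sound (P ++ [ v ]) f v (w ∷ vs) (∈-++⁺ˡ f∈P) (∈-++⁺ʳ P (here refl)) (λ v≡f → f∉vs (here (sym v≡f)))
      (f∉vs ∘ there) walk closes

  pathRest-sound : ∀ P p ws x → p ∈ P → Consec Γ (p ∷ ws ++ [ x ]) → Sound Γ P (pathRest p ws)
  pathRest-sound P p [] x _ _ = tt
  pathRest-sound P p (w ∷ ws) x p∈P (p~w , walk) =
    ([] ∷ []) , ((p∈P , Adj-sym Γ p~w) ∷ []) , pathRest-sound (P ++ [ w ]) w ws x (∈-++⁺ʳ P (here refl)) walk

  consec-lastOf : ∀ p ws x → Consec Γ (p ∷ ws ++ [ x ]) → Adj Γ (lastOf p ws) x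
  consec-lastOf p [] x (p~x , _) = p~x
  consec-lastOf p (w ∷ ws) x (_ , walk) = consec-lastOf w ws x walk

  closing-edge : ∀ x xs → lastAdjFirst Γ (x ∷ xs) → Adj Γ (lastOf x xs) x
  closing-edge x [] closes = closes
  closing-edge x (z ∷ []) closes = closes
  closing-edge x (z ∷ z′ ∷ zs) closes = closing-edge x (z′ ∷ zs) closes

  ¬Adj⇒none : ∀ r c → ¬ Adj Γ r c → σ Γ r c ≡ none
  ¬Adj⇒none r c ¬r~c with σ Γ r c
  ... | none = refl
  ... | plus = ⊥-elim (¬r~c (λ ()))
  ... | minus = ⊥-elim (¬r~c (λ ()))

  cycleRest-nbrs : ∀ P f p v vs → Complete Γ P (cycleRest f p (v ∷ vs)) → ∀ a → a ∈ P → Adj Γ v a → a ≡ p ⊎ a ≡ f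
  cycleRest-nbrs P f p v [] (declared , _) a a∈P v~a with declared a a∈P v~a
  ... | here a≡p = inj₁ a≡p
  ... | there (here a≡f) = inj₂ a≡f
  cycleRest-nbrs P f p v (w ∷ vs) (declared , _) a a∈P v~a with declared a a∈P v~a
  ... | here a≡p = inj₁ a≡p

  cycleRest-step : ∀ P f p v w vs → Complete Γ P (cycleRest f p (v ∷ w ∷ vs)) →
    (∀ a → a ∈ P → Adj Γ v a → a ≡ p) × Complete Γ (P ++ [ v ]) (cycleRest f v (w ∷ vs))
  cycleRest-step P f p v w vs (declared , rest) = (λ a a∈P v~a → ∈-single (declared a a∈P v~a)) , rest

-- Induced ∞-subgraphs

-- ∞(p, q, l): the cycles u₀ u₁ u₂ us and x₀ x₁ x₂ xs joined by the path u₀ ws x₀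
record ∞Shape (n : ℕ) : Set where
  constructor mk∞
  field
    u₀ u₁ u₂ : Fin n
    us ws : List (Fin n)
    x₀ x₁ x₂ : Fin n
    xs : List (Fin n)

  cycle₁ cycle₂ ∞-vertices : List (Fin n)
  cycle₁ = u₀ ∷ u₁ ∷ u₂ ∷ us
  cycle₂ = x₀ ∷ x₁ ∷ x₂ ∷ xs
  ∞-vertices = cycle₁ ++ ws ++ cycle₂

  layout₁ layout₂ ∞-layout : Layout n
  layout₁ = (u₀ , []) ∷ (u₁ , [ u₀ ]) ∷ cycleRest u₀ u₁ (u₂ ∷ us)
  layout₂ = (x₀ , [ lastOf u₀ ws ]) ∷ (x₁ , [ x₀ ]) ∷ cycleRest x₀ x₁ (x₂ ∷ xs)
  ∞-layout = layout₁ ++ pathRest u₀ ws ++ layout₂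

record Embedded {n} (Γ : SignedGraph n) (I : ∞Shape n) : Set where
  open ∞Shape I
  field
    walk₁ : Consec Γ cycle₁
    closes₁ : Adj Γ (lastOf u₂ us) u₀
    walk₂ : Consec Γ cycle₂
    closes₂ : Adj Γ (lastOf x₂ xs) x₀
    bridge : Consec Γ (u₀ ∷ ws ++ [ x₀ ])
    distinct : Unique ∞-vertices

record Induced {n} (Γ : SignedGraph n) (I : ∞Shape n) : Set where
  open ∞Shape I
  field
    rest₁ : Complete Γ (u₀ ∷ u₁ ∷ []) (cycleRest u₀ u₁ (u₂ ∷ us))
    path : Complete Γ cycle₁ (pathRest u₀ ws)
    x₀-nbrs : ∀ a → a ∈ cycle₁ ++ ws → Adj Γ x₀ a → a ≡ lastOf u₀ ws
    x₁-nbrs : ∀ a → a ∈ (cycle₁ ++ ws) ++ [ x₀ ] → Adj Γ x₁ a → a ≡ x₀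
    x₂-nbrs : ∀ a → a ∈ ((cycle₁ ++ ws) ++ [ x₀ ]) ++ [ x₁ ] → Adj Γ x₂ a → a ≡ x₁ ⊎ a ≡ x₀

module _ {n : ℕ} (Γ : SignedGraph n) (I : ∞Shape n) where
  open ∞Shape I

  ∞-vertices-layout : vertices ∞-layout ≡ ∞-vertices
  ∞-vertices-layout = trans (LP.map-++ proj₁ layout₁ _)
    (cong₂ _++_ (cong (λ z → u₀ ∷ u₁ ∷ z) (vertices-cycleRest u₀ u₁ (u₂ ∷ us)))
      (trans (LP.map-++ proj₁ (pathRest u₀ ws) _)
        (cong₂ _++_ (vertices-pathRest u₀ ws) (cong (λ z → x₀ ∷ x₁ ∷ z) (vertices-cycleRest x₀ x₁ (x₂ ∷ xs))))))

  ∞-declared : declared ∞-layout ≡ suc (length ∞-layout)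
  ∞-declared = begin
    declared (layout₁ ++ P ++ layout₂)
      ≡⟨ trans (declared-++ layout₁ _) (cong (declared layout₁ N.+_) (declared-++ P layout₂)) ⟩
    declared layout₁ N.+ (declared P N.+ declared layout₂)
      ≡⟨ cong₂ N._+_ (cong suc (declared-cycleRest u₀ u₁ u₂ us))
               (cong₂ N._+_ (declared-pathRest u₀ ws) (cong (suc ∘ suc) (declared-cycleRest x₀ x₁ x₂ xs))) ⟩
    length layout₁ N.+ (length P N.+ suc (length layout₂))
      ≡⟨ trans (cong (length layout₁ N.+_) (NP.+-suc (length P) _)) (NP.+-suc (length layout₁) _) ⟩
    suc (length layout₁ N.+ (length P N.+ length layout₂))
      ≡⟨ cong suc (trans (LP.length-++ layout₁ {P ++ layout₂}) (cong (length layout₁ N.+_) (LP.length-++ P {layout₂}))) ⟨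
    suc (length (layout₁ ++ P ++ layout₂)) ∎
    where
    open ≡-Reasoning
    P : Layout n
    P = pathRest u₀ ws

  ∞-sound : Embedded Γ I → Sound Γ [] ∞-layout
  ∞-sound E = sound-++ Γ [] layout₁ _ sound₁ (subst (λ Q → Sound Γ Q (pathRest u₀ ws ++ layout₂)) (sym vertices₁) sound-rest)
    where
    open Embedded E
    vertices₁ : vertices layout₁ ≡ cycle₁
    vertices₁ = cong (λ z → u₀ ∷ u₁ ∷ z) (vertices-cycleRest u₀ u₁ (u₂ ∷ us))
    u₀∉ : All (u₀ ≢_) ((u₁ ∷ u₂ ∷ us) ++ ws ++ cycle₂)
    u₀∉ = AllPairs.head distinct
    U₂ : Unique cycle₂
    U₂ = unique-++ʳ ws (unique-++ʳ cycle₁ distinct)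
    sound₁ : Sound Γ [] layout₁
    sound₁ = [] , [] , ([] ∷ []) , ((here refl , Adj-sym Γ (proj₁ walk₁)) ∷ []) ,
      cycleRest-sound Γ (u₀ ∷ u₁ ∷ []) u₀ u₁ (u₂ ∷ us) (here refl) (there (here refl))
        (λ u₁≡u₀ → All.head u₀∉ (sym u₁≡u₀)) (λ u₀∈ → All.lookup (All.tail u₀∉) (∈-++⁺ˡ u₀∈) refl)
        (proj₂ walk₁) closes₁
    Q₀ : List (Fin n)
    Q₀ = cycle₁ ++ ws
    sound₂ : Sound Γ Q₀ layout₂
    sound₂ = ([] ∷ []) , ((lastOf-∈ cycle₁ u₀ ws (here refl) , Adj-sym Γ (consec-lastOf Γ u₀ ws x₀ bridge)) ∷ []) ,
      ([] ∷ []) , ((∈-++⁺ʳ Q₀ (here refl) , Adj-sym Γ (proj₁ walk₂)) ∷ []) ,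
      cycleRest-sound Γ ((Q₀ ++ [ x₀ ]) ++ [ x₁ ]) x₀ x₁ (x₂ ∷ xs)
        (∈-++⁺ˡ (∈-++⁺ʳ Q₀ (here refl))) (∈-++⁺ʳ (Q₀ ++ [ x₀ ]) (here refl))
        (λ x₁≡x₀ → All.head (AllPairs.head U₂) (sym x₁≡x₀)) (λ x₀∈ → All.lookup (AllPairs.head U₂) (there x₀∈) refl)
        (proj₂ walk₂) closes₂
    sound-rest : Sound Γ cycle₁ (pathRest u₀ ws ++ layout₂)
    sound-rest = sound-++ Γ cycle₁ (pathRest u₀ ws) _ (pathRest-sound Γ cycle₁ u₀ ws x₀ (here refl) bridge)
      (subst (λ z → Sound Γ (cycle₁ ++ z) layout₂) (sym (vertices-pathRest u₀ ws)) sound₂)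

  complete⇒induced : Complete Γ [] ∞-layout → Induced Γ I
  complete⇒induced C = record
    { rest₁ = rest₁
    ; path = proj₁ path-and-rest
    ; x₀-nbrs = λ a a∈ x₀~a → ∈-single (proj₁ C₂ a a∈ x₀~a)
    ; x₁-nbrs = λ a a∈ x₁~a → ∈-single (proj₁ (proj₂ C₂) a a∈ x₁~a)
    ; x₂-nbrs = cycleRest-nbrs Γ _ x₀ x₁ x₂ xs (proj₂ (proj₂ C₂))
    }
    where
    C₁,rest : Complete Γ [] layout₁ × Complete Γ ([] ++ vertices layout₁) (pathRest u₀ ws ++ layout₂)
    C₁,rest = complete-++ Γ [] layout₁ _ C
    rest₁ : Complete Γ (u₀ ∷ u₁ ∷ []) (cycleRest u₀ u₁ (u₂ ∷ us))
    rest₁ = proj₂ (proj₂ (proj₁ C₁,rest))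
    path-and-rest : Complete Γ cycle₁ (pathRest u₀ ws) × Complete Γ (cycle₁ ++ vertices (pathRest u₀ ws)) layout₂
    path-and-rest = complete-++ Γ cycle₁ (pathRest u₀ ws) _
      (subst (λ Q → Complete Γ Q (pathRest u₀ ws ++ layout₂))
             (cong (λ z → u₀ ∷ u₁ ∷ z) (vertices-cycleRest u₀ u₁ (u₂ ∷ us))) (proj₂ C₁,rest))
    C₂ : Complete Γ (cycle₁ ++ ws) layout₂
    C₂ = subst (λ z → Complete Γ (cycle₁ ++ z) layout₂) (vertices-pathRest u₀ ws) (proj₂ path-and-rest)
  ∞-induced : Bicyclic Γ → Embedded Γ I → ∀ T → Unique (∞-vertices ++ vertices T) → Sound Γ ∞-vertices T →
    declared T ≡ length T → Induced Γ I × Complete Γ ∞-vertices T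
  ∞-induced bicyclic E T distinct sound-T declared-T =
    complete⇒induced (proj₁ split) , subst (λ Q → Complete Γ Q T) ∞-vertices-layout (proj₂ split)
    where
    vertices≡ : vertices (∞-layout ++ T) ≡ ∞-vertices ++ vertices T
    vertices≡ = trans (LP.map-++ proj₁ ∞-layout T) (cong (_++ vertices T) ∞-vertices-layout)
    sound : Sound Γ [] (∞-layout ++ T)
    sound = sound-++ Γ [] ∞-layout T (∞-sound E) (subst (λ Q → Sound Γ Q T) (sym ∞-vertices-layout) sound-T)
    declared≡ : declared (∞-layout ++ T) ≡ suc (length (∞-layout ++ T))
    declared≡ = trans (declared-++ ∞-layout T) (trans (cong₂ N._+_ ∞-declared declared-T)
                  (cong suc (sym (LP.length-++ ∞-layout))))
    split : Complete Γ [] ∞-layout × Complete Γ ([] ++ vertices ∞-layout) T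
    split = complete-++ Γ [] ∞-layout T
      (bicyclic-complete Γ bicyclic (∞-layout ++ T) (subst (u₀ ∈_) (sym vertices≡) (here refl))
        (subst Unique (sym vertices≡) distinct) sound declared≡)

  ∞-induced₀ : Bicyclic Γ → Embedded Γ I → Induced Γ I
  ∞-induced₀ bicyclic E = proj₁ (∞-induced bicyclic E []
    (subst Unique (sym (LP.++-identityʳ ∞-vertices)) (Embedded.distinct E)) tt refl)

-- Six pivots inside an induced ∞(p, q, l)

record SixPivots {n} (Γ : SignedGraph n) : Set where
  field
    pairs : List (Fin n × Fin n)
    triangular : Triangular Γ pairs
    columns : List (Fin n)
    distinct : Unique columns
    six : length columns ≡ 6
    ⊆pairs : ∀ c → c ∈ columns → c ∈ cols pairs

sixPivots⇒nullity : ∀ {n} (Γ : SignedGraph n) → SixPivots Γ → ∀ m → KernelHasIndep Γ m → m N.+ 6 ≤ n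
sixPivots⇒nullity Γ S m indep = subst (λ c → m N.+ c ≤ _) six
  (triangular-nullity Γ pairs triangular columns distinct ⊆pairs m indep)
  where open SixPivots S

unique-⊆ : ∀ {n} {xs ys : List (Fin n)} → xs ⊆ ys → Unique ys → Unique xs
unique-⊆ [] u = u
unique-⊆ (y ∷ʳ xs⊆ys) (_ ∷ u) = unique-⊆ xs⊆ys u
unique-⊆ (refl ∷ xs⊆ys) (y∉ ∷ u) = All.tabulate (λ x∈ → All.lookup y∉ (Sublist.lookup xs⊆ys x∈)) ∷ unique-⊆ xs⊆ys u

module _ {n : ℕ} (Γ : SignedGraph n) where

  not-neighbour : ∀ {Q : List (Fin n)} {c r} {N : Fin n → Set} →
    (∀ a → a ∈ Q → Adj Γ c a → N a) → r ∈ Q → ¬ N r → σ Γ r c ≡ none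
  not-neighbour nbrs r∈Q ¬Nr = ¬Adj⇒none Γ _ _ (λ r~c → ¬Nr (nbrs _ r∈Q (Adj-sym Γ r~c)))

  none-sym : ∀ {a b} → σ Γ a b ≡ none → σ Γ b a ≡ none
  none-sym {a} {b} = trans (SignedGraph.sym Γ b a)

module NonAdjacency {n : ℕ} (Γ : SignedGraph n) (I : ∞Shape n) (E : Embedded Γ I) (F : Induced Γ I) where
  open ∞Shape I public
  open Embedded E public
  open Induced F public

  separated : ∀ {a b} → a ∈ cycle₁ → b ∈ ws ++ cycle₂ → a ≢ b
  separated = unique-++-disjoint cycle₁ distinct

  x₀∈ : x₀ ∈ ws ++ cycle₂
  x₀∈ = ∈-++⁺ʳ ws (here refl)

  x₁∈ : x₁ ∈ ws ++ cycle₂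
  x₁∈ = ∈-++⁺ʳ ws (there (here refl))

  Q₁ : List (Fin n)
  Q₁ = (cycle₁ ++ ws) ++ [ x₀ ]

  ¬x₀ : ∀ {r} → r ∈ cycle₁ ++ ws → r ≢ lastOf u₀ ws → σ Γ r x₀ ≡ none
  ¬x₀ = not-neighbour Γ x₀-nbrs

  ¬x₁ : ∀ {r} → r ∈ Q₁ → r ≢ x₀ → σ Γ r x₁ ≡ none
  ¬x₁ = not-neighbour Γ x₁-nbrs

  ¬x₂ : ∀ {r} → r ∈ Q₁ → r ≢ x₁ → r ≢ x₀ → σ Γ r x₂ ≡ none
  ¬x₂ r∈ r≢x₁ r≢x₀ = not-neighbour Γ x₂-nbrs (∈-++⁺ˡ r∈) [ r≢x₁ , r≢x₀ ]′

  ¬x₁′ : ∀ {r} → r ∈ cycle₁ → σ Γ r x₁ ≡ none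
  ¬x₁′ r∈ = ¬x₁ (∈-++⁺ˡ (∈-++⁺ˡ r∈)) (separated r∈ x₀∈)

  ¬x₂′ : ∀ {r} → r ∈ cycle₁ → σ Γ r x₂ ≡ none
  ¬x₂′ r∈ = ¬x₂ (∈-++⁺ˡ (∈-++⁺ˡ r∈)) (separated r∈ x₁∈) (separated r∈ x₀∈)

  x₁~x₂ : Adj Γ x₁ x₂
  x₁~x₂ = proj₁ (proj₂ walk₂)

  x-pivots : Triangular Γ ((x₁ , x₂) ∷ (x₂ , x₁) ∷ [])
  x-pivots = x₁~x₂ , (loopless Γ x₁ ∷ []) , Adj-sym Γ x₁~x₂ , [] , tt

  u₀∈ : u₀ ∈ cycle₁
  u₀∈ = here refl

  u₁∈ : u₁ ∈ cycle₁
  u₁∈ = there (here refl)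

  u₂∈ : u₂ ∈ cycle₁
  u₂∈ = there (there (here refl))

  u₀≢u₁ : u₀ ≢ u₁
  u₀≢u₁ = All.head (AllPairs.head distinct)

  u₀≢u₂ : u₀ ≢ u₂
  u₀≢u₂ = All.head (All.tail (AllPairs.head distinct))

  u₁≢u₂ : u₁ ≢ u₂
  u₁≢u₂ = All.head (AllPairs.head (AllPairs.tail distinct))

-- l ≥ 3: pivots on u₁ u₂, on the path, and on x₁ x₂
pivots-long-path : ∀ {n} (Γ : SignedGraph n) {u0 u1 u2 ur w1 wr x0 x1 x2 xr} →
  let I = mk∞ u0 u1 u2 ur (w1 ∷ wr) x0 x1 x2 xr in Embedded Γ I → Induced Γ I → SixPivots Γ
pivots-long-path {n} Γ {u0} {u1} {u2} {ur} {w1} {wr} {x0} {x1} {x2} {xr} E F = go wr refl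
  where
  open NonAdjacency Γ _ E F
  w₁∈ : w1 ∈ ws ++ cycle₂
  w₁∈ = here refl
  w₁-nbrs : ∀ a → a ∈ cycle₁ → Adj Γ w1 a → a ∈ [ u0 ]
  w₁-nbrs = proj₁ path
  ¬w₁ : ∀ {r} → r ∈ cycle₁ → r ≢ u0 → σ Γ r w1 ≡ none
  ¬w₁ r∈ r≢u₀ = not-neighbour Γ w₁-nbrs r∈ (r≢u₀ ∘ ∈-single)
  w₁∈Q₁ : w1 ∈ Q₁
  w₁∈Q₁ = ∈-++⁺ˡ (∈-++⁺ʳ cycle₁ (here refl))
  u₁~u₂ : Adj Γ u1 u2
  u₁~u₂ = proj₁ (proj₂ walk₁)
  -- s is the successor of w1 on the path
  pivots : (s : Fin n) → Adj Γ w1 s → (∀ {r} → r ∈ cycle₁ → r ≢ w1 → σ Γ r s ≡ none) →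
    (u1 ∷ u2 ∷ w1 ∷ s ∷ x1 ∷ x2 ∷ []) ⊆ ∞-vertices → SixPivots Γ
  pivots s w₁~s ¬s sub = record
    { pairs = (u1 , u2) ∷ (u2 , u1) ∷ (u0 , w1) ∷ (w1 , s) ∷ (x1 , x2) ∷ (x2 , x1) ∷ []
    ; triangular =
        u₁~u₂ ,
          (loopless Γ u1 ∷ ¬w₁ u₁∈ (u₀≢u₁ ∘ sym) ∷ ¬s u₁∈ (separated u₁∈ w₁∈) ∷ ¬x₂′ u₁∈ ∷ ¬x₁′ u₁∈ ∷ []) ,
        Adj-sym Γ u₁~u₂ ,
          (¬w₁ u₂∈ (u₀≢u₂ ∘ sym) ∷ ¬s u₂∈ (separated u₂∈ w₁∈) ∷ ¬x₂′ u₂∈ ∷ ¬x₁′ u₂∈ ∷ []) ,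
        proj₁ bridge , (¬s u₀∈ (separated u₀∈ w₁∈) ∷ ¬x₂′ u₀∈ ∷ ¬x₁′ u₀∈ ∷ []) ,
        w₁~s , (¬x₂ w₁∈Q₁ (unique-++-disjoint ws (unique-++ʳ cycle₁ distinct) (here refl) (there (here refl)))
                         (unique-++-disjoint ws (unique-++ʳ cycle₁ distinct) (here refl) (here refl))
               ∷ ¬x₁ w₁∈Q₁ (unique-++-disjoint ws (unique-++ʳ cycle₁ distinct) (here refl) (here refl)) ∷ []) ,
        x-pivots
    ; columns = u1 ∷ u2 ∷ w1 ∷ s ∷ x1 ∷ x2 ∷ []
    ; distinct = unique-⊆ sub distinct
    ; six = refl
    ; ⊆pairs = λ where
        _ (here refl) → there (here refl)
        _ (there (here refl)) → here refl
        _ (there (there (here refl))) → there (there (here refl))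
        _ (there (there (there (here refl)))) → there (there (there (here refl)))
        _ (there (there (there (there (here refl))))) → there (there (there (there (there (here refl)))))
        _ (there (there (there (there (there (here refl)))))) → there (there (there (there (here refl))))
    }
  go : ∀ wr′ → wr′ ≡ wr → SixPivots Γ
  go [] refl = pivots x0 (proj₁ (proj₂ bridge)) (λ r∈ r≢w₁ → ¬x₀ (∈-++⁺ˡ r∈) r≢w₁)
    (u0 ∷ʳ refl ∷ refl ∷ ++⁺ˡ ur (refl ∷ refl ∷ refl ∷ refl ∷ minimum xr))
  go (w2 ∷ wr′) refl = pivots w2 (proj₁ (proj₂ bridge))
    (λ r∈ r≢w₁ → not-neighbour Γ (proj₁ (proj₂ path)) (∈-++⁺ˡ r∈) (r≢w₁ ∘ ∈-single))
    (u0 ∷ʳ refl ∷ refl ∷ ++⁺ˡ ur (refl ∷ refl ∷ ++⁺ˡ wr′ (x0 ∷ʳ refl ∷ refl ∷ minimum xr)))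

-- l = 2 and p ≥ 5
pivots-cycle≥5 : ∀ {n} (Γ : SignedGraph n) {u0 u1 u2 u3 u4 ur x0 x1 x2 xr} →
  let I = mk∞ u0 u1 u2 (u3 ∷ u4 ∷ ur) [] x0 x1 x2 xr in Embedded Γ I → Induced Γ I → SixPivots Γ
pivots-cycle≥5 {n} Γ {u0} {u1} {u2} {u3} {u4} {ur} {x0} {x1} {x2} {xr} E F = record
  { pairs = (u3 , u2) ∷ (u2 , u1) ∷ (ul , u0) ∷ (u0 , x0) ∷ (x1 , x2) ∷ (x2 , x1) ∷ []
  ; triangular =
      Adj-sym Γ u₂~u₃ , (none-sym Γ (not-neighbour Γ u₃-nbrs (there (here refl)) u₁≢u₂) ∷
                         none-sym Γ (not-neighbour Γ u₃-nbrs (here refl) u₀≢u₂) ∷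
                         ¬x₀′ u₃∈ (u₀≢u₃ ∘ sym) ∷ ¬x₂′ u₃∈ ∷ ¬x₁′ u₃∈ ∷ []) ,
      Adj-sym Γ u₁~u₂ , (none-sym Γ (not-neighbour Γ u₂-nbrs (here refl) u₀≢u₁) ∷
                         ¬x₀′ u₂∈ (u₀≢u₂ ∘ sym) ∷ ¬x₂′ u₂∈ ∷ ¬x₁′ u₂∈ ∷ []) ,
      closes₁ , (¬x₀′ ul∈ ul≢u₀ ∷ ¬x₂′ ul∈ ∷ ¬x₁′ ul∈ ∷ []) ,
      proj₁ bridge , (¬x₂′ u₀∈ ∷ ¬x₁′ u₀∈ ∷ []) ,
      x-pivots
  ; columns = u0 ∷ u1 ∷ u2 ∷ x0 ∷ x1 ∷ x2 ∷ []
  ; distinct = unique-⊆ (refl ∷ refl ∷ refl ∷ ++⁺ˡ (u3 ∷ u4 ∷ ur) (refl ∷ refl ∷ refl ∷ minimum xr)) distinct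
  ; six = refl
  ; ⊆pairs = λ where
      _ (here refl) → there (there (here refl))
      _ (there (here refl)) → there (here refl)
      _ (there (there (here refl))) → here refl
      _ (there (there (there (here refl)))) → there (there (there (here refl)))
      _ (there (there (there (there (here refl))))) → there (there (there (there (there (here refl)))))
      _ (there (there (there (there (there (here refl)))))) → there (there (there (there (here refl))))
  }
  where
  open NonAdjacency Γ _ E F
  ul : Fin n
  ul = lastOf u4 ur
  u₃∈ : u3 ∈ cycle₁
  u₃∈ = there (there (there (here refl)))
  ul∈ : ul ∈ cycle₁
  ul∈ = there (there (there (there (lastOf-∈ [ u4 ] u4 ur (here refl)))))
  ul≢u₀ : ul ≢ u0
  ul≢u₀ ul≡u₀ = All.lookup (AllPairs.head distinct) (∈-++⁺ˡ (there (there (there (lastOf-∈ [ u4 ] u4 ur (here refl)))))) (sym ul≡u₀)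
  u₀≢u₃ : u0 ≢ u3
  u₀≢u₃ = All.head (All.tail (All.tail (AllPairs.head distinct)))
  ¬x₀′ : ∀ {r} → r ∈ cycle₁ → r ≢ u0 → σ Γ r x0 ≡ none
  ¬x₀′ r∈ = ¬x₀ (∈-++⁺ˡ r∈)
  steps : (∀ a → a ∈ u0 ∷ u1 ∷ [] → Adj Γ u2 a → a ≡ u1) × Complete Γ (u0 ∷ u1 ∷ u2 ∷ []) (cycleRest u0 u2 (u3 ∷ u4 ∷ ur))
  steps = cycleRest-step Γ (u0 ∷ u1 ∷ []) u0 u1 u2 u3 (u4 ∷ ur) rest₁
  u₂-nbrs : ∀ a → a ∈ u0 ∷ u1 ∷ [] → Adj Γ u2 a → a ≡ u1
  u₂-nbrs = proj₁ steps
  u₃-nbrs : ∀ a → a ∈ u0 ∷ u1 ∷ u2 ∷ [] → Adj Γ u3 a → a ≡ u2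
  u₃-nbrs = proj₁ (cycleRest-step Γ (u0 ∷ u1 ∷ u2 ∷ []) u0 u2 u3 u4 ur (proj₂ steps))
  u₁~u₂ : Adj Γ u1 u2
  u₁~u₂ = proj₁ (proj₂ walk₁)
  u₂~u₃ : Adj Γ u2 u3
  u₂~u₃ = proj₁ (proj₂ (proj₂ walk₁))

-- l = 2 and p = 4
pivots-cycle4 : ∀ {n} (Γ : SignedGraph n) {u0 u1 u2 u3 x0 x1 x2 xr} →
  let I = mk∞ u0 u1 u2 (u3 ∷ []) [] x0 x1 x2 xr in Embedded Γ I → Induced Γ I → SixPivots Γ
pivots-cycle4 {n} Γ {u0} {u1} {u2} {u3} {x0} {x1} {x2} {xr} E F = record
  { pairs = (u2 , u3) ∷ (u0 , x0) ∷ (x1 , x2) ∷ (x2 , x1) ∷ (x0 , u0) ∷ (u1 , u2) ∷ []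
  ; triangular =
      u₂~u₃ , (¬x₀₂ ∷ ¬x₂′ u₂∈ ∷ ¬x₁′ u₂∈ ∷ none-sym Γ ¬u₀u₂ ∷ loopless Γ u2 ∷ []) ,
      proj₁ bridge , (¬x₂′ u₀∈ ∷ ¬x₁′ u₀∈ ∷ loopless Γ u0 ∷ ¬u₀u₂ ∷ []) ,
      x₁~x₂ , (loopless Γ x1 ∷ none-sym Γ (¬x₁′ u₀∈) ∷ none-sym Γ (¬x₁′ u₂∈) ∷ []) ,
      Adj-sym Γ x₁~x₂ , (none-sym Γ (¬x₂′ u₀∈) ∷ none-sym Γ (¬x₂′ u₂∈) ∷ []) ,
      Adj-sym Γ (proj₁ bridge) , (none-sym Γ ¬x₀₂ ∷ []) ,
      proj₁ (proj₂ walk₁) , [] , tt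
  ; columns = u0 ∷ u2 ∷ u3 ∷ x0 ∷ x1 ∷ x2 ∷ []
  ; distinct = unique-⊆ (refl ∷ u1 ∷ʳ refl ∷ refl ∷ refl ∷ refl ∷ refl ∷ minimum xr) distinct
  ; six = refl
  ; ⊆pairs = λ where
      _ (here refl) → there (there (there (there (here refl))))
      _ (there (here refl)) → there (there (there (there (there (here refl)))))
      _ (there (there (here refl))) → here refl
      _ (there (there (there (here refl)))) → there (here refl)
      _ (there (there (there (there (here refl))))) → there (there (there (here refl)))
      _ (there (there (there (there (there (here refl)))))) → there (there (here refl))
  }
  where
  open NonAdjacency Γ _ E F
  ¬x₀₂ : σ Γ u2 x0 ≡ none
  ¬x₀₂ = ¬x₀ (∈-++⁺ˡ u₂∈) (u₀≢u₂ ∘ sym)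
  ¬u₀u₂ : σ Γ u0 u2 ≡ none
  ¬u₀u₂ = not-neighbour Γ (proj₁ (cycleRest-step Γ (u0 ∷ u1 ∷ []) u0 u1 u2 u3 [] rest₁)) (here refl) u₀≢u₁
  u₂~u₃ : Adj Γ u2 u3
  u₂~u₃ = proj₁ (proj₂ (proj₂ walk₁))

-- l = 2 and p = q = 3: a vertex t outside the two triangles, adjacent to exactly the vertex v of the first one,
-- replaces the missing pivot
pivots-triangles : ∀ {n} (Γ : SignedGraph n) {u0 u1 u2 x0 x1 x2} →
  let I = mk∞ u0 u1 u2 [] [] x0 x1 x2 [] in Embedded Γ I → Induced Γ I →
  ∀ t v → (∀ a → a ∈ ∞Shape.∞-vertices I → Adj Γ t a → a ≡ v) → Adj Γ t v →
  ∀ c r r′ → v ∈ ∞Shape.cycle₁ I → c ∈ ∞Shape.cycle₁ I → r ∈ ∞Shape.cycle₁ I → r′ ∈ ∞Shape.cycle₁ I →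
  r ≢ u0 → r′ ≢ u0 → c ≢ v → r ≢ v → Adj Γ r c → Adj Γ r′ r →
  (∀ a → a ∈ ∞Shape.cycle₁ I → a ∈ v ∷ c ∷ r ∷ []) → SixPivots Γ
pivots-triangles {n} Γ {u0} {u1} {u2} {x0} {x1} {x2} E F t v t-nbrs t~v
                 c r r′ v∈ c∈ r∈ r′∈ r≢u₀ r′≢u₀ c≢v r≢v r~c r′~r triangle = record
  { pairs = (t , v) ∷ (r , c) ∷ (r′ , r) ∷ (u0 , x0) ∷ (x1 , x2) ∷ (x2 , x1) ∷ []
  ; triangular =
      t~v , (¬t (on₁ c∈) c≢v ∷ ¬t (on₁ r∈) r≢v ∷ ¬t x₀∈′ (λ x₀≡v → separated v∈ x₀∈ (sym x₀≡v)) ∷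
             ¬t x₂∈′ (λ x₂≡v → separated v∈ (there (there (here refl))) (sym x₂≡v)) ∷
             ¬t x₁∈′ (λ x₁≡v → separated v∈ x₁∈ (sym x₁≡v)) ∷ []) ,
      r~c , (loopless Γ r ∷ ¬x₀ r∈ r≢u₀ ∷ ¬x₂′ r∈ ∷ ¬x₁′ r∈ ∷ []) ,
      r′~r , (¬x₀ r′∈ r′≢u₀ ∷ ¬x₂′ r′∈ ∷ ¬x₁′ r′∈ ∷ []) ,
      proj₁ bridge , (¬x₂′ u₀∈ ∷ ¬x₁′ u₀∈ ∷ []) ,
      x-pivots
  ; columns = u0 ∷ u1 ∷ u2 ∷ x0 ∷ x1 ∷ x2 ∷ []
  ; distinct = distinct
  ; six = refl
  ; ⊆pairs = λ where
      a (here refl) → first-three (triangle a (here refl))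
      a (there (here refl)) → first-three (triangle a (there (here refl)))
      a (there (there (here refl))) → first-three (triangle a (there (there (here refl))))
      _ (there (there (there (here refl)))) → there (there (there (here refl)))
      _ (there (there (there (there (here refl))))) → there (there (there (there (there (here refl)))))
      _ (there (there (there (there (there (here refl)))))) → there (there (there (there (here refl))))
  }
  where
  open NonAdjacency Γ _ E F
  ¬t : ∀ {a} → a ∈ ∞-vertices → a ≢ v → σ Γ t a ≡ none
  ¬t {a} a∈ a≢v = ¬Adj⇒none Γ t a (λ t~a → a≢v (t-nbrs a a∈ t~a))
  on₁ : ∀ {a} → a ∈ cycle₁ → a ∈ ∞-vertices
  on₁ = ∈-++⁺ˡ
  x₀∈′ : x0 ∈ ∞-vertices
  x₀∈′ = there (there (there (here refl)))
  x₁∈′ : x1 ∈ ∞-vertices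
  x₁∈′ = there (there (there (there (here refl))))
  x₂∈′ : x2 ∈ ∞-vertices
  x₂∈′ = there (there (there (there (there (here refl)))))
  first-three : ∀ {a} → a ∈ v ∷ c ∷ r ∷ [] → a ∈ v ∷ c ∷ r ∷ x0 ∷ x2 ∷ x1 ∷ []
  first-three (here a≡v) = here a≡v
  first-three (there (here a≡c)) = there (here a≡c)
  first-three (there (there (here a≡r))) = there (there (here a≡r))

unique-swap : ∀ {n} (A B : List (Fin n)) → Unique (A ++ B) → Unique (B ++ A)
unique-swap A B u = UniqueP.++⁺ (unique-++ʳ A u) (unique-++ˡ A u)
  (λ (b∈B , b∈A) → unique-++-disjoint A u b∈A b∈B refl)

swap-cycles : ∀ {n} {Γ : SignedGraph n} {u0 u1 u2 us x0 x1 x2 xs} →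
  Embedded Γ (mk∞ u0 u1 u2 us [] x0 x1 x2 xs) → Embedded Γ (mk∞ x0 x1 x2 xs [] u0 u1 u2 us)
swap-cycles {Γ = Γ} {u0} {u1} {u2} {us} E = record
  { walk₁ = walk₂ ; closes₁ = closes₂ ; walk₂ = walk₁ ; closes₂ = closes₁
  ; bridge = Adj-sym Γ (proj₁ bridge) , tt
  ; distinct = unique-swap (u0 ∷ u1 ∷ u2 ∷ us) _ distinct
  }
  where open Embedded E

module _ {n : ℕ} (Γ : SignedGraph n) (bicyclic : Bicyclic Γ) where

  pivots-cycle≥4 : ∀ {u0 u1 u2 u3 ur x0 x1 x2 xr} → Embedded Γ (mk∞ u0 u1 u2 (u3 ∷ ur) [] x0 x1 x2 xr) → SixPivots Γ
  pivots-cycle≥4 {ur = []} E = pivots-cycle4 Γ E (∞-induced₀ Γ _ bicyclic E)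
  pivots-cycle≥4 {ur = _ ∷ _} E = pivots-cycle≥5 Γ E (∞-induced₀ Γ _ bicyclic E)

  pivots-pendant : ∀ {u0 u1 u2 x0 x1 x2} → let I = mk∞ u0 u1 u2 [] [] x0 x1 x2 [] in Embedded Γ I →
    ∀ t → t ∉ ∞Shape.∞-vertices I → ∀ v → Adj Γ t v → v ∈ ∞Shape.cycle₁ I → SixPivots Γ
  pivots-pendant {u0} {u1} {u2} {x0} {x1} {x2} E t t∉ v t~v v∈ = pick v∈
    where
    open Embedded E
    V : List (Fin n)
    V = u0 ∷ u1 ∷ u2 ∷ x0 ∷ x1 ∷ x2 ∷ []
    V+t : Unique (V ++ [ t ])
    V+t = UniqueP.++⁺ distinct ([] ∷ []) (λ (a∈V , a∈t) → t∉ (subst (_∈ V) (∈-single a∈t) a∈V))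
    induced : Induced Γ _ × Complete Γ V ((t , [ v ]) ∷ [])
    induced = ∞-induced Γ _ bicyclic E ((t , [ v ]) ∷ []) V+t (([] ∷ []) , ((∈-++⁺ˡ v∈ , t~v) ∷ []) , tt) refl
    F : Induced Γ _
    F = proj₁ induced
    t-nbrs : ∀ a → a ∈ V → Adj Γ t a → a ≡ v
    t-nbrs a a∈ t~a = ∈-single (proj₁ (proj₂ induced) a a∈ t~a)
    open NonAdjacency Γ _ E F using (u₀≢u₁; u₀≢u₂; u₁≢u₂)
    u₀~u₁ : Adj Γ u0 u1
    u₀~u₁ = proj₁ walk₁
    u₁~u₂ : Adj Γ u1 u2
    u₁~u₂ = proj₁ (proj₂ walk₁)
    pick : v ∈ u0 ∷ u1 ∷ u2 ∷ [] → SixPivots Γ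
    pick (here refl) = pivots-triangles Γ E F t v t-nbrs t~v u2 u1 u2
      (here refl) (there (there (here refl))) (there (here refl)) (there (there (here refl)))
      (u₀≢u₁ ∘ sym) (u₀≢u₂ ∘ sym) (u₀≢u₂ ∘ sym) (u₀≢u₁ ∘ sym) u₁~u₂ (Adj-sym Γ u₁~u₂)
      (λ { _ (here e) → here e ; _ (there (here e)) → there (there (here e)) ; _ (there (there (here e))) → there (here e) })
    pick (there (here refl)) = pivots-triangles Γ E F t v t-nbrs t~v u0 u2 u1
      (there (here refl)) (here refl) (there (there (here refl))) (there (here refl))
      (u₀≢u₂ ∘ sym) (u₀≢u₁ ∘ sym) u₀≢u₁ (u₁≢u₂ ∘ sym) closes₁ u₁~u₂
      (λ { _ (here e) → there (here e) ; _ (there (here e)) → here e ; _ (there (there (here e))) → there (there (here e)) })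
    pick (there (there (here refl))) = pivots-triangles Γ E F t v t-nbrs t~v u0 u1 u2
      (there (there (here refl))) (here refl) (there (here refl)) (there (there (here refl)))
      (u₀≢u₁ ∘ sym) (u₀≢u₂ ∘ sym) u₀≢u₂ u₁≢u₂ (Adj-sym Γ u₀~u₁) (Adj-sym Γ u₁~u₂)
      (λ { _ (here e) → there (here e) ; _ (there (here e)) → there (there (here e)) ; _ (there (there (here e))) → here e })

  -- ∞(3, 3, 2) has six vertices, so the seventh vertex provides the pendant t
  pivots-two-triangles : 7 ≤ n → ∀ {u0 u1 u2 x0 x1 x2} → Embedded Γ (mk∞ u0 u1 u2 [] [] x0 x1 x2 []) → SixPivots Γ
  pivots-two-triangles n≥7 {u0} {u1} {u2} {x0} {x1} {x2} E = go (FP.any? (λ i → ¬? (DecMembership._∈?_ FP._≟_ i V)))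
    where
    V : List (Fin n)
    V = u0 ∷ u1 ∷ u2 ∷ x0 ∷ x1 ∷ x2 ∷ []
    go : Dec (∃ λ i → i ∉ V) → SixPivots Γ
    go (no all-in) = ⊥-elim (NP.<⇒≱ n≥7 (NP.≤-reflexive (begin
      n                                  ≡⟨ countNot+count (_∈ᵇ V) ⟨
      countNot (_∈ᵇ V) N.+ count (_∈ᵇ V) ≡⟨ cong₂ N._+_ (sumℕ-zero (λ i → cong (λ b → if b then 0 else 1) (inside i)))
                                                       (count-unique V (Embedded.distinct E)) ⟩
      6                                  ∎)))
      where
      open ≡-Reasoning
      inside : ∀ i → (i ∈ᵇ V) ≡ true
      inside i = ∈⇒∈ᵇ (decidable-stable (DecMembership._∈?_ FP._≟_ i V) (λ i∉V → all-in (i , i∉V)))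
    go (yes (y , y∉V)) with boundary-edge Γ V u0 (proj₁ (proj₁ bicyclic u0 y)) y (proj₂ (proj₁ bicyclic u0 y)) (here refl) y∉V
    ... | a , t , a∈V , t∉V , a~t = on-which-triangle a∈V
      where
      t~a : Adj Γ t a
      t~a = Adj-sym Γ a~t
      swap-∈ : ∀ {z} → z ∈ x0 ∷ x1 ∷ x2 ∷ u0 ∷ u1 ∷ u2 ∷ [] → z ∈ V
      swap-∈ (here e) = there (there (there (here e)))
      swap-∈ (there (here e)) = there (there (there (there (here e))))
      swap-∈ (there (there (here e))) = there (there (there (there (there (here e)))))
      swap-∈ (there (there (there z∈))) = ∈-++⁺ˡ z∈
      on-which-triangle : a ∈ V → SixPivots Γ
      on-which-triangle (here e) = pivots-pendant E t t∉V a t~a (here e)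
      on-which-triangle (there (here e)) = pivots-pendant E t t∉V a t~a (there (here e))
      on-which-triangle (there (there (here e))) = pivots-pendant E t t∉V a t~a (there (there (here e)))
      on-which-triangle (there (there (there a∈))) = pivots-pendant (swap-cycles E) t (t∉V ∘ swap-∈) a t~a a∈

  six-pivots : 7 ≤ n → (I : ∞Shape n) → Embedded Γ I → SixPivots Γ
  six-pivots n≥7 (mk∞ _ _ _ _ (_ ∷ _) _ _ _ _) E = pivots-long-path Γ E (∞-induced₀ Γ _ bicyclic E)
  six-pivots n≥7 (mk∞ _ _ _ (_ ∷ _) [] _ _ _ _) E = pivots-cycle≥4 E
  six-pivots n≥7 (mk∞ _ _ _ [] [] _ _ _ (_ ∷ _)) E = pivots-cycle≥4 (swap-cycles E)
  six-pivots n≥7 (mk∞ _ _ _ [] [] _ _ _ []) E = pivots-two-triangles n≥7 E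

-- The upper bound

Realised : ℕ → ℕ → Set
Realised n k = ∃ λ (Γ : SignedGraph n) → InBnPlus Γ × Unbalanced Γ × Nullity Γ k

embedded-∞ : ∀ {n} (Γ : SignedGraph n) → ContainsInfinity Γ → Σ (∞Shape n) (Embedded Γ)
embedded-∞ {n} Γ (u0 , us , x0 , xs , ws , C₁ , C₂ , bridge , distinct) = embed us xs C₁ C₂ distinct
  where
  embed : ∀ us xs → IsCycle Γ (u0 ∷ us) → IsCycle Γ (x0 ∷ xs) → Unique ((u0 ∷ us) ++ ws ++ (x0 ∷ xs)) →
    Σ (∞Shape n) (Embedded Γ)
  embed [] _ (s≤s () , _) _ _
  embed (_ ∷ []) _ (s≤s (s≤s ()) , _) _ _
  embed (_ ∷ _ ∷ _) [] _ (s≤s () , _) _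
  embed (_ ∷ _ ∷ _) (_ ∷ []) _ (s≤s (s≤s ()) , _) _
  embed (u1 ∷ u2 ∷ ur) (x1 ∷ x2 ∷ xr) (_ , _ , walk₁ , closes₁) (_ , _ , walk₂ , closes₂) distinct =
    mk∞ u0 u1 u2 ur ws x0 x1 x2 xr , record
      { walk₁ = walk₁ ; closes₁ = closing-edge Γ u0 (u1 ∷ u2 ∷ ur) closes₁
      ; walk₂ = walk₂ ; closes₂ = closing-edge Γ x0 (x1 ∷ x2 ∷ xr) closes₂
      ; bridge = bridge ; distinct = distinct }

nullity≤n∸6 : ∀ n → 7 ≤ n → ∀ k → Realised n k → k ≤ n ∸ 6
nullity≤n∸6 n n≥7 k (Γ , (bicyclic , ∞) , _ , (indep , _)) with embedded-∞ Γ ∞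
... | I , E = NP.m+n≤o⇒m≤o∸n k (sixPivots⇒nullity Γ (six-pivots Γ bicyclic n≥7 I E) k indep)

unit : ∀ {n} → Fin n → Fin n → ℚ
unit a j = if does (j FP.≟ a) then 1ℚ else 0ℚ

sum-*unit : ∀ {n} (f : Fin n → ℚ) (a : Fin n) → sumℚ (λ j → f j Q.* unit a j) ≡ f a
sum-*unit f a = trans (sumℚ-single a (λ j → f j Q.* unit a j) off) at-a
  where
  off : ∀ j → j ≢ a → f j Q.* unit a j ≡ 0ℚ
  off j j≢a rewrite dec-false (j FP.≟ a) j≢a = QP.*-zeroʳ (f j)
  at-a : f a Q.* unit a a ≡ f a
  at-a rewrite dec-true (a FP.≟ a) refl = QP.*-identityʳ (f a)

sum-*unit-unit : ∀ {n} (f : Fin n → ℚ) a b → sumℚ (λ j → f j Q.* (unit a j Q.+ Q.- unit b j)) ≡ f a Q.+ Q.- f b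
sum-*unit-unit f a b = begin
  sumℚ (λ j → f j Q.* (unit a j Q.+ Q.- unit b j))
    ≡⟨ sumℚ-cong (λ j → solve 3 (λ F x y → F :* (x :+ :- y) := F :* x :+ :- (F :* y)) refl (f j) (unit a j) (unit b j)) ⟩
  sumℚ (λ j → f j Q.* unit a j Q.+ Q.- (f j Q.* unit b j))
    ≡⟨ sumℚ-+ (λ j → f j Q.* unit a j) (λ j → Q.- (f j Q.* unit b j)) ⟩
  sumℚ (λ j → f j Q.* unit a j) Q.+ sumℚ (λ j → Q.- (f j Q.* unit b j))
    ≡⟨ cong₂ Q._+_ (sum-*unit f a) (trans (sumℚ-neg (λ j → f j Q.* unit b j)) (cong Q.-_ (sum-*unit f b))) ⟩
  f a Q.+ Q.- f b ∎
  where open ≡-Reasoning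

twins⇒inKernel : ∀ {n} (Γ : SignedGraph n) a b → (∀ i → σ Γ i a ≡ σ Γ i b) → InKernel Γ (λ j → unit a j Q.+ Q.- unit b j)
twins⇒inKernel Γ a b twins i = trans (sum-*unit-unit (λ j → entryℚ (σ Γ i j)) a b)
  (trans (cong (λ e → entryℚ e Q.+ Q.- entryℚ (σ Γ i b)) (twins i)) (QP.+-inverseʳ (entryℚ (σ Γ i b))))

private-coordinates⇒independent : ∀ {n k} (v : Fin k → Fin n → ℚ) (π : Fin k → Fin n) →
  (∀ t → v t (π t) ≡ 1ℚ) → (∀ t t′ → t′ ≢ t → v t′ (π t) ≡ 0ℚ) → LinIndep v
private-coordinates⇒independent v π one others c comb≡0 t = begin
  c t                                 ≡⟨ QP.*-identityʳ (c t) ⟨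
  c t Q.* 1ℚ                          ≡⟨ cong (c t Q.*_) (one t) ⟨
  c t Q.* v t (π t)                   ≡⟨ sumℚ-single t (λ t′ → c t′ Q.* v t′ (π t)) off ⟨
  sumℚ (λ t′ → c t′ Q.* v t′ (π t))   ≡⟨ comb≡0 (π t) ⟩
  0ℚ                                  ∎
  where
  open ≡-Reasoning
  off : ∀ t′ → t′ ≢ t → c t′ Q.* v t′ (π t) ≡ 0ℚ
  off t′ t′≢t = trans (cong (c t′ Q.*_) (others t t′ t′≢t)) (QP.*-zeroʳ (c t′))

sumList : List ℚ → ℚ
sumList [] = 0ℚ
sumList (x ∷ xs) = x Q.+ sumList xs

sum-over : ∀ {n} (f : Fin n → ℚ) (L : List (Fin n)) → Unique L → (∀ j → (j ∈ᵇ L) ≡ false → f j ≡ 0ℚ) →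
  sumℚ f ≡ sumList (L.map f L)
sum-over f [] _ outside = sumℚ-zero (λ j → outside j refl)
sum-over {n} f (a ∷ L) (a∉L ∷ uL) outside = begin
  sumℚ f                                       ≡⟨ sumℚ-cong split ⟩
  sumℚ (λ j → f j Q.* unit a j Q.+ g j)        ≡⟨ sumℚ-+ (λ j → f j Q.* unit a j) g ⟩
  sumℚ (λ j → f j Q.* unit a j) Q.+ sumℚ g     ≡⟨ cong₂ Q._+_ (sum-*unit f a) (sum-over g L uL outside-g) ⟩
  f a Q.+ sumList (L.map g L)                  ≡⟨ cong (λ xs → f a Q.+ sumList xs) (LP.map-cong-local (All.tabulate g≡f)) ⟩
  f a Q.+ sumList (L.map f L)                  ∎
  where
  open ≡-Reasoning
  g : Fin n → ℚ
  g j = if does (j FP.≟ a) then 0ℚ else f j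
  split : ∀ j → f j ≡ f j Q.* unit a j Q.+ g j
  split j with j FP.≟ a
  ... | yes _ = sym (trans (QP.+-identityʳ _) (QP.*-identityʳ (f j)))
  ... | no _ = sym (trans (cong (Q._+ f j) (QP.*-zeroʳ (f j))) (QP.+-identityˡ (f j)))
  outside-g : ∀ j → (j ∈ᵇ L) ≡ false → g j ≡ 0ℚ
  outside-g j j∉L with j FP.≟ a
  ... | yes _ = refl
  ... | no j≢a = outside j (trans (cong (_∨ (j ∈ᵇ L)) (dec-false (j FP.≟ a) j≢a)) j∉L)
  g≡f : ∀ {j} → j ∈ L → g j ≡ f j
  g≡f {j} j∈L with j FP.≟ a
  ... | yes refl = ⊥-elim (All≢⇒∉ a∉L j∈L)
  ... | no _ = refl

scaled : Entry → ℚ → ℚ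
scaled none x = 0ℚ
scaled plus x = x
scaled minus x = Q.- x

entryℚ-* : ∀ e x → entryℚ e Q.* x ≡ scaled e x
entryℚ-* none x = QP.*-zeroˡ x
entryℚ-* plus x = QP.*-identityˡ x
entryℚ-* minus x = solve 1 (λ x → :- con 1ℚ :* x := :- x) refl x

row-over : ∀ {n} (Γ : SignedGraph n) (w : Fin n → ℚ) r (nbrs : List (Fin n)) → Unique nbrs →
  (∀ j → (j ∈ᵇ nbrs) ≡ false → σ Γ r j ≡ none) →
  sumℚ (λ j → entryℚ (σ Γ r j) Q.* w j) ≡ sumList (L.map (λ j → scaled (σ Γ r j) (w j)) nbrs)
row-over Γ w r nbrs u none-outside = trans (sum-over (λ j → entryℚ (σ Γ r j) Q.* w j) nbrs u zero-outside)
  (cong sumList (LP.map-cong (λ j → entryℚ-* (σ Γ r j) (w j)) nbrs))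
  where
  zero-outside : ∀ j → (j ∈ᵇ nbrs) ≡ false → entryℚ (σ Γ r j) Q.* w j ≡ 0ℚ
  zero-outside j j∉ rewrite none-outside j j∉ = QP.*-zeroˡ (w j)

module _ {m : ℕ} where
  v0 v1 v2 v3 v4 v5 v6 : Fin (7 N.+ m)
  v0 = F.zero
  v1 = F.suc F.zero
  v2 = F.suc (F.suc F.zero)
  v3 = F.suc (F.suc (F.suc F.zero))
  v4 = F.suc (F.suc (F.suc (F.suc F.zero)))
  v5 = F.suc (F.suc (F.suc (F.suc (F.suc F.zero))))
  v6 = F.suc (F.suc (F.suc (F.suc (F.suc (F.suc F.zero)))))

  tv : Fin m → Fin (7 N.+ m)
  tv s = 7 F.↑ʳ s

  fin7+-cases : ∀ {ℓ} (P : Fin (7 N.+ m) → Set ℓ) → P v0 → P v1 → P v2 → P v3 → P v4 → P v5 → P v6 → (∀ s → P (tv s)) → ∀ j → P j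
  fin7+-cases P p0 p1 p2 p3 p4 p5 p6 pt F.zero = p0
  fin7+-cases P p0 p1 p2 p3 p4 p5 p6 pt (F.suc F.zero) = p1
  fin7+-cases P p0 p1 p2 p3 p4 p5 p6 pt (F.suc (F.suc F.zero)) = p2
  fin7+-cases P p0 p1 p2 p3 p4 p5 p6 pt (F.suc (F.suc (F.suc F.zero))) = p3
  fin7+-cases P p0 p1 p2 p3 p4 p5 p6 pt (F.suc (F.suc (F.suc (F.suc F.zero)))) = p4
  fin7+-cases P p0 p1 p2 p3 p4 p5 p6 pt (F.suc (F.suc (F.suc (F.suc (F.suc F.zero))))) = p5
  fin7+-cases P p0 p1 p2 p3 p4 p5 p6 pt (F.suc (F.suc (F.suc (F.suc (F.suc (F.suc F.zero)))))) = p6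
  fin7+-cases P p0 p1 p2 p3 p4 p5 p6 pt (F.suc (F.suc (F.suc (F.suc (F.suc (F.suc (F.suc s))))))) = pt s

WalkFromTo-++ : ∀ {n} (Γ : SignedGraph n) a vs c ws b → WalkFromTo Γ a c vs → WalkFromTo Γ c b ws → WalkFromTo Γ a b (vs ++ c ∷ ws)
WalkFromTo-++ Γ a [] c ws b (a~c , _) walk = a~c , walk
WalkFromTo-++ Γ a (v ∷ vs) c ws b (a~v , walk₁) walk₂ = a~v , WalkFromTo-++ Γ v vs c ws b walk₁ walk₂

WalkFromTo-reverse : ∀ {n} (Γ : SignedGraph n) a vs b → WalkFromTo Γ a b vs → WalkFromTo Γ b a (L.reverse vs)
WalkFromTo-reverse Γ a [] b (a~b , _) = Adj-sym Γ a~b , tt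
WalkFromTo-reverse Γ a (v ∷ vs) b (a~v , walk) = subst (WalkFromTo Γ b a) (sym (LP.unfold-reverse v vs))
  (WalkFromTo-++ Γ b (L.reverse vs) v [] a (WalkFromTo-reverse Γ v vs b walk) (Adj-sym Γ a~v , tt))

-- Graphs grown from a seven-vertex base by hanging trees

-- Vertex j ≥ 7 is a tree vertex joined by a positive edge to its parent, an earlier vertex;
-- vertices are handled through toℕ.
record Growth : Set where
  field
    base : ℕ → ℕ → Entry
    parent : ℕ → ℕ
    base-sym : ∀ i j → i < 7 → j < 7 → base i j ≡ base j i
    base-loopless : ∀ i → i < 7 → base i i ≡ none
    parent< : ∀ j → 7 ≤ j → parent j < j

module Grown (F : Growth) where
  open Growth F

  hangsFrom : ℕ → ℕ → Bool
  hangsFrom j i = (6 N.<ᵇ j) ∧ (parent j N.≡ᵇ i)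

  treeEdge : ℕ → ℕ → Bool
  treeEdge i j = hangsFrom j i ∨ hangsFrom i j

  entry : ℕ → ℕ → Entry
  entry i j = if (i N.<ᵇ 7) ∧ (j N.<ᵇ 7) then base i j else (if treeEdge i j then plus else none)

  entry-sym : ∀ i j → entry i j ≡ entry j i
  entry-sym i j with i N.<ᵇ 7 in i<7 | j N.<ᵇ 7 in j<7
  ... | true | true = base-sym i j (<ᵇ⇒< i<7) (<ᵇ⇒< j<7)
  ... | true | false rewrite BP.∨-comm (hangsFrom j i) (hangsFrom i j) = refl
  ... | false | true rewrite BP.∨-comm (hangsFrom j i) (hangsFrom i j) = refl
  ... | false | false rewrite BP.∨-comm (hangsFrom j i) (hangsFrom i j) = refl

  entry-loopless : ∀ i → entry i i ≡ none
  entry-loopless i with i N.<ᵇ 7 in i<7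
  ... | true = base-loopless i (<ᵇ⇒< i<7)
  ... | false rewrite ≡ᵇ-false {parent i} {i} (λ p≡i → NP.<-irrefl p≡i (parent< i (NP.≮⇒≥ (<ᵇ⇒≮ i<7)))) | BP.∧-zeroʳ (6 N.<ᵇ i) = refl

  grown : ∀ m → SignedGraph (7 N.+ m)
  grown m = record
    { σ = λ i j → entry (toℕ i) (toℕ j)
    ; sym = λ i j → entry-sym (toℕ i) (toℕ j)
    ; loopless = λ i → entry-loopless (toℕ i)
    }

  entry-base : ∀ i j → i < 7 → j < 7 → entry i j ≡ base i j
  entry-base i j i<7 j<7 rewrite <ᵇ-true i<7 | <ᵇ-true j<7 = refl

  entry-tree : ∀ i j → 7 ≤ j → entry i j ≡ (if treeEdge i j then plus else none)
  entry-tree i j 7≤j rewrite <ᵇ-false {j} {7} (NP.≤⇒≯ 7≤j) | BP.∧-zeroʳ (i N.<ᵇ 7) = refl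

  treeEdge-at : ∀ x J → 7 ≤ J → treeEdge x J ≡ ((parent J N.≡ᵇ x) ∨ hangsFrom x J)
  treeEdge-at x J 7≤J rewrite <ᵇ-true {6} {J} 7≤J = refl

  entry-parent : ∀ J → 7 ≤ J → entry (parent J) J ≡ plus
  entry-parent J 7≤J rewrite entry-tree (parent J) J 7≤J | treeEdge-at (parent J) J 7≤J
                           | ≡ᵇ-true {parent J} refl = refl

  parentᶠ : ∀ {m} (J : Fin (7 N.+ m)) → 7 ≤ toℕ J → Fin (7 N.+ m)
  parentᶠ J 7≤J = F.fromℕ< (NP.<-trans (parent< (toℕ J) 7≤J) (FP.toℕ<n J))

  toℕ-parentᶠ : ∀ {m} (J : Fin (7 N.+ m)) 7≤J → toℕ (parentᶠ J 7≤J) ≡ parent (toℕ J)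
  toℕ-parentᶠ J 7≤J = FP.toℕ-fromℕ< _

  baseEdges : ℕ
  baseEdges = sumℕ {7} (λ j → sumℕ {7} (λ i → if (toℕ i N.<ᵇ toℕ j) ∧ isEdgeᵇ (base (toℕ i) (toℕ j)) then 1 else 0))

  module _ (m : ℕ) where
    private
      Γ : SignedGraph (7 N.+ m)
      Γ = grown m

    isEdge-if : ∀ b → isEdgeᵇ (if b then plus else none) ≡ b
    isEdge-if true = refl
    isEdge-if false = refl

    arcs-into-tree : ∀ (J : Fin (7 N.+ m)) → 7 ≤ toℕ J → sumℕ (λ i → arc Γ i J) ≡ 1
    arcs-into-tree J 7≤J = trans (sumℕ-single P (λ i → arc Γ i J) others) at-parent
      where
      P : Fin (7 N.+ m)
      P = parentᶠ J 7≤J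
      arc-tree : ∀ x → (if (x N.<ᵇ toℕ J) ∧ isEdgeᵇ (entry x (toℕ J)) then 1 else 0) ≡
                       (if (x N.<ᵇ toℕ J) ∧ treeEdge x (toℕ J) then 1 else 0)
      arc-tree x rewrite entry-tree x (toℕ J) 7≤J | isEdge-if (treeEdge x (toℕ J)) = refl
      at-parent : arc Γ P J ≡ 1
      at-parent rewrite arc-tree (toℕ P) | toℕ-parentᶠ J 7≤J | <ᵇ-true (parent< (toℕ J) 7≤J)
                      | treeEdge-at (parent (toℕ J)) (toℕ J) 7≤J | ≡ᵇ-true {parent (toℕ J)} refl = refl
      others : ∀ i → i ≢ P → arc Γ i J ≡ 0
      others i i≢P rewrite arc-tree (toℕ i) with toℕ i N.<ᵇ toℕ J in i<J
      ... | false = refl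
      ... | true rewrite treeEdge-at (toℕ i) (toℕ J) 7≤J
                       | ≡ᵇ-false {parent (toℕ J)} {toℕ i} (λ p≡i → i≢P (FP.toℕ-injective (trans (sym p≡i) (sym (toℕ-parentᶠ J 7≤J)))))
                   with 6 N.<ᵇ toℕ i in 6<i
      ...   | false = refl
      ...   | true rewrite ≡ᵇ-false {parent (toℕ i)} {toℕ J}
                              (λ p≡J → NP.<-irrefl p≡J (NP.<-trans (parent< (toℕ i) (<ᵇ⇒< 6<i)) (<ᵇ⇒< i<J))) = refl

    arcs-into-base : ∀ (j : Fin 7) → sumℕ (λ i → arc Γ i (j F.↑ˡ m)) ≡
      sumℕ {7} (λ i → if (toℕ i N.<ᵇ toℕ j) ∧ isEdgeᵇ (base (toℕ i) (toℕ j)) then 1 else 0)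
    arcs-into-base j = trans (sumℕ-++ 7 (λ i → arc Γ i (j F.↑ˡ m)))
      (trans (cong₂ N._+_ (sumℕ-cong from-base) (sumℕ-zero from-tree)) (NP.+-identityʳ _))
      where
      from-base : ∀ i → arc Γ (i F.↑ˡ m) (j F.↑ˡ m) ≡ (if (toℕ i N.<ᵇ toℕ j) ∧ isEdgeᵇ (base (toℕ i) (toℕ j)) then 1 else 0)
      from-base i rewrite FP.toℕ-↑ˡ i m | FP.toℕ-↑ˡ j m | entry-base (toℕ i) (toℕ j) (FP.toℕ<n i) (FP.toℕ<n j) = refl
      from-tree : ∀ i → arc Γ (7 F.↑ʳ i) (j F.↑ˡ m) ≡ 0
      from-tree i rewrite FP.toℕ-↑ˡ j m
        | <ᵇ-false {7 N.+ toℕ i} {toℕ j} (λ lt → NP.<-irrefl refl (NP.<-trans (FP.toℕ<n j) (NP.≤-trans (s≤s (NP.m≤m+n 7 (toℕ i))) lt))) = refl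

    edgeCount-grown : baseEdges ≡ 8 → edgeCount Γ ≡ suc (7 N.+ m)
    edgeCount-grown eight = begin
      edgeCount Γ
        ≡⟨ sumℕ-swap (arc Γ) ⟩
      sumℕ (λ j → sumℕ (λ i → arc Γ i j))
        ≡⟨ sumℕ-++ 7 (λ j → sumℕ (λ i → arc Γ i j)) ⟩
      sumℕ {7} (λ j → sumℕ (λ i → arc Γ i (j F.↑ˡ m))) N.+ sumℕ {m} (λ j → sumℕ (λ i → arc Γ i (7 F.↑ʳ j)))
        ≡⟨ cong₂ N._+_ (trans (sumℕ-cong arcs-into-base) eight)
                       (trans (sumℕ-cong (λ j → arcs-into-tree (7 F.↑ʳ j) (subst (7 ≤_) (sym (FP.toℕ-↑ʳ 7 j)) (NP.m≤m+n 7 (toℕ j)))))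
                              (sumℕ-one m)) ⟩
      8 N.+ m ∎
      where open ≡-Reasoning

    connected-grown : (∀ (i : Fin 7) → Σ (List (Fin (7 N.+ m))) λ vs → WalkFromTo Γ (i F.↑ˡ m) F.zero vs) → Connected Γ
    connected-grown base-walks i j = proj₁ to₀ᵢ ++ F.zero ∷ L.reverse (proj₁ to₀ⱼ) ,
      WalkFromTo-++ Γ i (proj₁ to₀ᵢ) F.zero (L.reverse (proj₁ to₀ⱼ)) j (proj₂ to₀ᵢ)
        (WalkFromTo-reverse Γ j (proj₁ to₀ⱼ) F.zero (proj₂ to₀ⱼ))
      where
      to₀ : ∀ fuel (J : Fin (7 N.+ m)) → toℕ J < fuel → Σ (List (Fin (7 N.+ m))) λ vs → WalkFromTo Γ J F.zero vs
      to₀ (suc fuel) J J<fuel with toℕ J N.<? 7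
      ... | yes J<7 = subst (λ K → Σ (List (Fin (7 N.+ m))) λ vs → WalkFromTo Γ K F.zero vs) ↑ˡ≡J (base-walks (F.fromℕ< J<7))
        where
        ↑ˡ≡J : F.fromℕ< J<7 F.↑ˡ m ≡ J
        ↑ˡ≡J = FP.toℕ-injective (trans (FP.toℕ-↑ˡ (F.fromℕ< J<7) m) (FP.toℕ-fromℕ< J<7))
      ... | no J≮7 = P ∷ proj₁ rest , J~P , proj₂ rest
        where
        7≤J : 7 ≤ toℕ J
        7≤J = NP.≮⇒≥ J≮7
        P : Fin (7 N.+ m)
        P = parentᶠ J 7≤J
        rest : Σ (List (Fin (7 N.+ m))) λ vs → WalkFromTo Γ P F.zero vs
        rest = to₀ fuel P (NP.≤-trans (subst (λ p → suc p ≤ toℕ J) (sym (toℕ-parentᶠ J 7≤J)) (parent< (toℕ J) 7≤J)) (NP.≤-pred J<fuel))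
        J~P : Adj Γ J P
        J~P J-P≡none with trans (sym (entry-parent (toℕ J) 7≤J))
                            (trans (cong (λ p → entry p (toℕ J)) (sym (toℕ-parentᶠ J 7≤J))) (trans (entry-sym (toℕ P) (toℕ J)) J-P≡none))
        ... | ()
      to₀ᵢ : Σ (List (Fin (7 N.+ m))) λ vs → WalkFromTo Γ i F.zero vs
      to₀ᵢ = to₀ (suc (toℕ i)) i (NP.n<1+n (toℕ i))
      to₀ⱼ : Σ (List (Fin (7 N.+ m))) λ vs → WalkFromTo Γ j F.zero vs
      to₀ⱼ = to₀ (suc (toℕ j)) j (NP.n<1+n (toℕ j))

    σ-tree : ∀ i (J : Fin (7 N.+ m)) → 7 ≤ toℕ J → σ Γ i J ≡ (if treeEdge (toℕ i) (toℕ J) then plus else none)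
    σ-tree i J 7≤J = entry-tree (toℕ i) (toℕ J) 7≤J

    row-tree : ∀ (w : Fin (7 N.+ m) → ℚ) (J P : Fin (7 N.+ m)) (Ch : List (Fin (7 N.+ m))) → 7 ≤ toℕ J →
      toℕ P ≡ parent (toℕ J) → (∀ x → 7 ≤ toℕ x → parent (toℕ x) ≡ toℕ J → x ∈ Ch) →
      (∀ c → c ∈ Ch → 7 ≤ toℕ c × parent (toℕ c) ≡ toℕ J) → Unique (P ∷ Ch) →
      sumℚ (λ j → entryℚ (σ Γ J j) Q.* w j) ≡ w P Q.+ sumList (L.map w Ch)
    row-tree w J P Ch 7≤J P≡ children only-children u =
      trans (row-over Γ w J (P ∷ Ch) u off) (cong sumList (LP.map-cong-local (All.tabulate on)))
      where
      σJ : ∀ x → σ Γ J x ≡ (if (parent (toℕ J) N.≡ᵇ toℕ x) ∨ hangsFrom (toℕ x) (toℕ J) then plus else none)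
      σJ x = trans (entry-sym (toℕ J) (toℕ x)) (trans (σ-tree x J 7≤J) (cong (λ b → if b then plus else none) (treeEdge-at (toℕ x) (toℕ J) 7≤J)))
      off : ∀ j → (j ∈ᵇ P ∷ Ch) ≡ false → σ Γ J j ≡ none
      off j j∉ rewrite σJ j with parent (toℕ J) N.≡ᵇ toℕ j in p≡j
      ... | true = ⊥-elim (∈ᵇ-false⇒∉ {L = P ∷ Ch} j∉ (here (FP.toℕ-injective (trans (sym (≡ᵇ⇒≡ p≡j)) (sym P≡)))))
      ... | false with 6 N.<ᵇ toℕ j in 6<j
      ...   | false = refl
      ...   | true with parent (toℕ j) N.≡ᵇ toℕ J in pj≡J
      ...     | false = refl
      ...     | true = ⊥-elim (∈ᵇ-false⇒∉ {L = P ∷ Ch} j∉ (there (children j (<ᵇ⇒< 6<j) (≡ᵇ⇒≡ pj≡J))))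
      on : ∀ {j} → j ∈ P ∷ Ch → scaled (σ Γ J j) (w j) ≡ w j
      on {j} (here refl) rewrite σJ P | P≡ | ≡ᵇ-true {parent (toℕ J)} refl = refl
      on {j} (there j∈Ch) rewrite σJ j with only-children j j∈Ch
      ... | 7≤j , pj≡J rewrite <ᵇ-true {6} {toℕ j} 7≤j | pj≡J | ≡ᵇ-true {toℕ J} refl
                             | BP.∨-zeroʳ (parent (toℕ J) N.≡ᵇ toℕ j) = refl

    σ-base-tree : ∀ (b : Fin (7 N.+ m)) → toℕ b < 7 → ∀ s → σ Γ b (tv s) ≡ (if parent (7 N.+ toℕ s) N.≡ᵇ toℕ b then plus else none)
    σ-base-tree b b<7 s rewrite σ-tree b (tv s) (subst (7 ≤_) (sym (FP.toℕ-↑ʳ 7 s)) (NP.m≤m+n 7 (toℕ s)))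
      | FP.toℕ-↑ʳ 7 s | treeEdge-at (toℕ b) (7 N.+ toℕ s) (NP.m≤m+n 7 (toℕ s))
      | <ᵇ-false {6} {toℕ b} (λ 6<b → NP.<-irrefl refl (NP.<-≤-trans 6<b (NP.≤-pred b<7)))
      | BP.∨-identityʳ (parent (7 N.+ toℕ s) N.≡ᵇ toℕ b) = refl

    σ-leaf : ∀ (J : Fin (7 N.+ m)) → 7 ≤ toℕ J → (∀ x → 7 ≤ x → parent x ≢ toℕ J) → ∀ i →
      σ Γ i J ≡ (if parent (toℕ J) N.≡ᵇ toℕ i then plus else none)
    σ-leaf J 7≤J leaf i rewrite σ-tree i J 7≤J | treeEdge-at (toℕ i) (toℕ J) 7≤J with 6 N.<ᵇ toℕ i in 6<i
    ... | false = cong (λ b → if b then plus else none) (BP.∨-identityʳ _)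
    ... | true rewrite ≡ᵇ-false {parent (toℕ i)} {toℕ J} (leaf (toℕ i) (<ᵇ⇒< 6<i)) = cong (λ b → if b then plus else none) (BP.∨-identityʳ _)

_≟ᴱ_ : (a b : Entry) → Dec (a ≡ b)
none ≟ᴱ none = yes refl
plus ≟ᴱ plus = yes refl
minus ≟ᴱ minus = yes refl
none ≟ᴱ plus = no (λ ())
none ≟ᴱ minus = no (λ ())
plus ≟ᴱ none = no (λ ())
plus ≟ᴱ minus = no (λ ())
minus ≟ᴱ none = no (λ ())
minus ≟ᴱ plus = no (λ ())

unique? : ∀ {n} (L : List (Fin n)) → Dec (Unique L)
unique? = AllPairs.allPairs? (λ x y → ¬? (x FP.≟ y))

distinct! : ∀ {n} (L : List (Fin n)) → {ok : True (unique? L)} → Unique L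
distinct! L {ok} = toWitness {a? = unique? L} ok

base-sym! : (base : ℕ → ℕ → Entry) →
  {ok : True (FP.all? (λ (a : Fin 7) → FP.all? (λ (b : Fin 7) → base (toℕ a) (toℕ b) ≟ᴱ base (toℕ b) (toℕ a))))} →
  ∀ i j → i < 7 → j < 7 → base i j ≡ base j i
base-sym! base {ok} i j i<7 j<7 =
  subst₂ (λ x y → base x y ≡ base y x) (FP.toℕ-fromℕ< i<7) (FP.toℕ-fromℕ< j<7)
    (toWitness {a? = FP.all? (λ a → FP.all? (λ b → base (toℕ a) (toℕ b) ≟ᴱ base (toℕ b) (toℕ a)))} ok (F.fromℕ< i<7) (F.fromℕ< j<7))

base-loopless! : (base : ℕ → ℕ → Entry) → {ok : True (FP.all? (λ (a : Fin 7) → base (toℕ a) (toℕ a) ≟ᴱ none))} →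
  ∀ i → i < 7 → base i i ≡ none
base-loopless! base {ok} i i<7 = subst (λ x → base x x ≡ none) (FP.toℕ-fromℕ< i<7)
  (toWitness {a? = FP.all? (λ a → base (toℕ a) (toℕ a) ≟ᴱ none)} ok (F.fromℕ< i<7))

-- The family with nullity n − 6

baseB : ℕ → ℕ → Entry
baseB 0 1 = plus
baseB 1 0 = plus
baseB 0 2 = plus
baseB 2 0 = plus
baseB 1 2 = minus
baseB 2 1 = minus
baseB 0 3 = plus
baseB 3 0 = plus
baseB 3 4 = plus
baseB 4 3 = plus
baseB 4 5 = plus
baseB 5 4 = plus
baseB 5 6 = plus
baseB 6 5 = plus
baseB 6 3 = plus
baseB 3 6 = plus
baseB _ _ = none

growthB : Growth
growthB = record
  { base = baseB
  ; parent = λ _ → 0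
  ; base-sym = base-sym! baseB
  ; base-loopless = base-loopless! baseB
  ; parent< = λ j 7≤j → NP.<-≤-trans (s≤s z≤n) 7≤j
  }

module FamilyB (m : ℕ) where
  open Grown growthB using (grown; connected-grown; edgeCount-grown)

  Γ : SignedGraph (7 N.+ m)
  Γ = grown m

  bicyclic : Bicyclic Γ
  bicyclic = connected-grown m to₀ , edgeCount-grown m refl
    where
    to₀ : ∀ (i : Fin 7) → Σ (List (Fin (7 N.+ m))) λ vs → WalkFromTo Γ (i F.↑ˡ m) F.zero vs
    to₀ F.zero = v1 ∷ [] , (λ ()) , (λ ()) , tt
    to₀ (F.suc F.zero) = [] , (λ ()) , tt
    to₀ (F.suc (F.suc F.zero)) = [] , (λ ()) , tt
    to₀ (F.suc (F.suc (F.suc F.zero))) = [] , (λ ()) , tt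
    to₀ (F.suc (F.suc (F.suc (F.suc F.zero)))) = v3 ∷ [] , (λ ()) , (λ ()) , tt
    to₀ (F.suc (F.suc (F.suc (F.suc (F.suc F.zero))))) = v4 ∷ v3 ∷ [] , (λ ()) , (λ ()) , (λ ()) , tt
    to₀ (F.suc (F.suc (F.suc (F.suc (F.suc (F.suc F.zero)))))) = v3 ∷ [] , (λ ()) , (λ ()) , tt

  triangle : IsCycle Γ (v0 ∷ v1 ∷ v2 ∷ [])
  triangle = s≤s (s≤s (s≤s z≤n)) , distinct! (v0 ∷ v1 ∷ v2 ∷ []) , ((λ ()) , (λ ()) , tt) , (λ ())

  infinity : ContainsInfinity Γ
  infinity = v0 , (v1 ∷ v2 ∷ []) , v3 , (v4 ∷ v5 ∷ v6 ∷ []) , [] , triangle ,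
    (s≤s (s≤s (s≤s z≤n)) , distinct! (v3 ∷ v4 ∷ v5 ∷ v6 ∷ []) , ((λ ()) , (λ ()) , (λ ()) , tt) , (λ ())) ,
    ((λ ()) , tt) , distinct! (v0 ∷ v1 ∷ v2 ∷ v3 ∷ v4 ∷ v5 ∷ v6 ∷ [])

  unbalanced : Unbalanced Γ
  unbalanced = (v0 ∷ v1 ∷ v2 ∷ []) , triangle , refl

  -- 4 and 6 are twins on the 4-cycle; a pendant s at 0 is balanced by 3 and 5
  kernel : Fin (suc m) → Fin (7 N.+ m) → ℚ
  kernel F.zero j = unit v4 j Q.+ Q.- unit v6 j
  kernel (F.suc s) j = (unit (tv s) j Q.+ Q.- unit v3 j) Q.+ unit v5 j

  kernel-inKernel : ∀ t → InKernel Γ (kernel t)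
  kernel-inKernel F.zero = twins⇒inKernel Γ v4 v6 (fin7+-cases (λ i → σ Γ i v4 ≡ σ Γ i v6) refl refl refl refl refl refl refl (λ _ → refl))
  kernel-inKernel (F.suc s) i = begin
    sumℚ (λ j → a j Q.* ((unit (tv s) j Q.+ Q.- unit v3 j) Q.+ unit v5 j))
      ≡⟨ sumℚ-cong (λ j → QP.*-distribˡ-+ (a j) (unit (tv s) j Q.+ Q.- unit v3 j) (unit v5 j)) ⟩
    sumℚ (λ j → a j Q.* (unit (tv s) j Q.+ Q.- unit v3 j) Q.+ a j Q.* unit v5 j)
      ≡⟨ sumℚ-+ (λ j → a j Q.* (unit (tv s) j Q.+ Q.- unit v3 j)) (λ j → a j Q.* unit v5 j) ⟩
    sumℚ (λ j → a j Q.* (unit (tv s) j Q.+ Q.- unit v3 j)) Q.+ sumℚ (λ j → a j Q.* unit v5 j)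
      ≡⟨ cong₂ Q._+_ (sum-*unit-unit a (tv s) v3) (sum-*unit a v5) ⟩
    a (tv s) Q.+ Q.- a v3 Q.+ a v5
      ≡⟨ fin7+-cases (λ i → entryℚ (σ Γ i (tv s)) Q.+ Q.- entryℚ (σ Γ i v3) Q.+ entryℚ (σ Γ i v5) ≡ 0ℚ)
                     refl refl refl refl refl refl refl (λ _ → refl) i ⟩
    0ℚ ∎
    where
    open ≡-Reasoning
    a : Fin (7 N.+ m) → ℚ
    a j = entryℚ (σ Γ i j)

  kernel-independent : LinIndep kernel
  kernel-independent = private-coordinates⇒independent kernel coordinate one others
    where
    coordinate : Fin (suc m) → Fin (7 N.+ m)
    coordinate F.zero = v4
    coordinate (F.suc s) = tv s
    one : ∀ t → kernel t (coordinate t) ≡ 1ℚ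
    one F.zero = refl
    one (F.suc s) rewrite dec-true (s FP.≟ s) refl = refl
    others : ∀ t t′ → t′ ≢ t → kernel t′ (coordinate t) ≡ 0ℚ
    others F.zero F.zero t′≢t = ⊥-elim (t′≢t refl)
    others F.zero (F.suc s′) _ = refl
    others (F.suc s) F.zero _ = refl
    others (F.suc s) (F.suc s′) t′≢t rewrite dec-false (s FP.≟ s′) (λ s≡s′ → t′≢t (cong F.suc (sym s≡s′))) = refl

  pivots : List (Fin (7 N.+ m) × Fin (7 N.+ m))
  pivots = (v5 , v6) ∷ (v3 , v0) ∷ (v1 , v2) ∷ (v2 , v1) ∷ (v0 , v3) ∷ (v4 , v5) ∷ []

  pivots-triangular : Triangular Γ pivots
  pivots-triangular =
    (λ ()) , (refl ∷ refl ∷ refl ∷ refl ∷ refl ∷ []) , (λ ()) , (refl ∷ refl ∷ refl ∷ refl ∷ []) ,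
    (λ ()) , (refl ∷ refl ∷ refl ∷ []) , (λ ()) , (refl ∷ refl ∷ []) , (λ ()) , (refl ∷ []) , (λ ()) , [] , tt

  nullity : Nullity Γ (suc m)
  nullity = (kernel , kernel-inKernel , kernel-independent) , λ k indep →
    NP.+-cancelʳ-≤ 6 k (suc m) (subst (k N.+ 6 ≤_) (cong suc (NP.+-comm 6 m))
      (triangular-nullity Γ pivots pivots-triangular (cols pivots) (distinct! (cols pivots)) (λ _ c∈ → c∈) k indep))

-- The families with nullity k ≤ n − 7

baseA : ℕ → ℕ → Entry
baseA 0 1 = plus
baseA 1 0 = plus
baseA 0 2 = plus
baseA 2 0 = plus
baseA 1 2 = minus
baseA 2 1 = minus
baseA 0 3 = plus
baseA 3 0 = plus
baseA 3 4 = plus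
baseA 4 3 = plus
baseA 3 5 = plus
baseA 5 3 = plus
baseA 4 5 = plus
baseA 5 4 = plus
baseA 0 6 = plus
baseA 6 0 = plus
baseA _ _ = none

-- the tree vertices 7, …, 6 + k are pendant at 0; from 7 + k on they form a path hanging from 3
parentA : ℕ → ℕ → ℕ
parentA k j = if j N.<ᵇ 7 N.+ k then 0 else (if j N.≡ᵇ 7 N.+ k then 3 else N.pred j)

parentA-cases : ∀ k j → (j < 7 N.+ k × parentA k j ≡ 0) ⊎ (j ≡ 7 N.+ k × parentA k j ≡ 3) ⊎ (7 N.+ k < j × parentA k j ≡ N.pred j)
parentA-cases k j with NP.<-cmp j (7 N.+ k)
... | tri< j<7+k _ _ rewrite <ᵇ-true j<7+k = inj₁ (j<7+k , refl)
... | tri≈ _ refl _ rewrite <ᵇ-false {7 N.+ k} {7 N.+ k} (NP.<-irrefl refl) | ≡ᵇ-true {7 N.+ k} refl = inj₂ (inj₁ (refl , refl))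
... | tri> _ j≢ j>7+k rewrite <ᵇ-false (NP.<⇒≯ j>7+k) | ≡ᵇ-false j≢ = inj₂ (inj₂ (j>7+k , refl))

parentA< : ∀ k j → 7 ≤ j → parentA k j < j
parentA< k j 7≤j with parentA-cases k j
... | inj₁ (_ , p≡0) rewrite p≡0 = NP.<-≤-trans (s≤s z≤n) 7≤j
... | inj₂ (inj₁ (refl , p≡3)) rewrite p≡3 = s≤s (s≤s (s≤s (s≤s z≤n)))
... | inj₂ (inj₂ (j>7+k , p≡pred)) rewrite p≡pred = pred< j (NP.<-≤-trans (s≤s z≤n) 7≤j)
  where
  pred< : ∀ j → 0 < j → N.pred j < j
  pred< (suc j) _ = NP.n<1+n j

parentA≢base : ∀ k j b → 7 ≤ j → b ≢ 0 → b ≢ 3 → b < 7 → parentA k j ≢ b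
parentA≢base k j b 7≤j b≢0 b≢3 b<7 p≡b with parentA-cases k j
... | inj₁ (_ , p≡0) = b≢0 (trans (sym p≡b) p≡0)
... | inj₂ (inj₁ (_ , p≡3)) = b≢3 (trans (sym p≡b) p≡3)
... | inj₂ (inj₂ (j>7+k , p≡pred)) = NP.<-irrefl refl (NP.<-≤-trans b<7
      (subst (7 ≤_) (trans (sym p≡pred) p≡b) (NP.≤-trans (NP.m≤m+n 7 k) (NP.<⇒≤pred j>7+k))))

growthA : ℕ → Growth
growthA k = record
  { base = baseA
  ; parent = parentA k
  ; base-sym = base-sym! baseA
  ; base-loopless = base-loopless! baseA
  ; parent< = parentA< k
  }

coefficient : ℕ → ℚ
coefficient zero = 1ℚ
coefficient (suc zero) = 1ℚ Q.+ 1ℚ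
coefficient (suc (suc i)) = Q.- coefficient i

coefficient≢0 : ∀ i → coefficient i ≢ 0ℚ
coefficient≢0 zero ()
coefficient≢0 (suc zero) ()
coefficient≢0 (suc (suc i)) c≡0 = coefficient≢0 i (QP.neg-injective c≡0)

x+y≡0⇒y≡-x : ∀ {x y : ℚ} → x Q.+ y ≡ 0ℚ → y ≡ Q.- x
x+y≡0⇒y≡-x {x} {y} x+y≡0 = trans (solve 2 (λ x y → y := (x :+ y) :+ :- x) refl x y)
  (trans (cong (Q._+ Q.- x) x+y≡0) (QP.+-identityˡ (Q.- x)))

x≡0⇒x+y≡0⇒y≡0 : ∀ {x y : ℚ} → x ≡ 0ℚ → x Q.+ y ≡ 0ℚ → y ≡ 0ℚ
x≡0⇒x+y≡0⇒y≡0 {y = y} refl 0+y≡0 = trans (sym (QP.+-identityˡ y)) 0+y≡0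

module FamilyA (k r : ℕ) where
  open Grown (growthA k) using (grown; connected-grown; edgeCount-grown; σ-base-tree; σ-leaf; row-tree; entry-parent)

  N : ℕ
  N = 7 N.+ (k N.+ r)

  Γ : SignedGraph N
  Γ = grown (k N.+ r)

  bicyclic : Bicyclic Γ
  bicyclic = connected-grown (k N.+ r) to₀ , edgeCount-grown (k N.+ r) refl
    where
    to₀ : ∀ (i : Fin 7) → Σ (List (Fin N)) λ vs → WalkFromTo Γ (i F.↑ˡ (k N.+ r)) F.zero vs
    to₀ F.zero = v1 ∷ [] , (λ ()) , (λ ()) , tt
    to₀ (F.suc F.zero) = [] , (λ ()) , tt
    to₀ (F.suc (F.suc F.zero)) = [] , (λ ()) , tt
    to₀ (F.suc (F.suc (F.suc F.zero))) = [] , (λ ()) , tt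
    to₀ (F.suc (F.suc (F.suc (F.suc F.zero)))) = v3 ∷ [] , (λ ()) , (λ ()) , tt
    to₀ (F.suc (F.suc (F.suc (F.suc (F.suc F.zero))))) = v3 ∷ [] , (λ ()) , (λ ()) , tt
    to₀ (F.suc (F.suc (F.suc (F.suc (F.suc (F.suc F.zero)))))) = [] , (λ ()) , tt

  triangle : IsCycle Γ (v0 ∷ v1 ∷ v2 ∷ [])
  triangle = s≤s (s≤s (s≤s z≤n)) , distinct! (v0 ∷ v1 ∷ v2 ∷ []) , ((λ ()) , (λ ()) , tt) , (λ ())

  infinity : ContainsInfinity Γ
  infinity = v0 , (v1 ∷ v2 ∷ []) , v3 , (v4 ∷ v5 ∷ []) , [] , triangle ,
    (s≤s (s≤s (s≤s z≤n)) , distinct! (v3 ∷ v4 ∷ v5 ∷ []) , ((λ ()) , (λ ()) , tt) , (λ ())) ,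
    ((λ ()) , tt) , distinct! (v0 ∷ v1 ∷ v2 ∷ v3 ∷ v4 ∷ v5 ∷ [])

  unbalanced : Unbalanced Γ
  unbalanced = (v0 ∷ v1 ∷ v2 ∷ []) , triangle , refl

  pendant : Fin k → Fin N
  pendant t = tv (t F.↑ˡ r)

  toℕ-pendant : ∀ t → toℕ (pendant t) ≡ 7 N.+ toℕ t
  toℕ-pendant t = trans (FP.toℕ-↑ʳ 7 (t F.↑ˡ r)) (cong (7 N.+_) (FP.toℕ-↑ˡ t r))

  7≤pendant : ∀ t → 7 ≤ toℕ (pendant t)
  7≤pendant t = subst (7 ≤_) (sym (toℕ-pendant t)) (NP.m≤m+n 7 (toℕ t))

  parent-pendant : ∀ t → parentA k (toℕ (pendant t)) ≡ 0
  parent-pendant t rewrite FP.toℕ-↑ˡ t r | <ᵇ-true (FP.toℕ<n t) = refl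

  pendant-leaf : ∀ t x → 7 ≤ x → parentA k x ≢ toℕ (pendant t)
  pendant-leaf t x 7≤x p≡ with parentA-cases k x | trans p≡ (toℕ-pendant t)
  ... | inj₁ (_ , p≡0) | p≡7+t = 0≢7+ (trans (sym p≡0) p≡7+t)
    where
    0≢7+ : ∀ {y} → 0 ≢ 7 N.+ y
    0≢7+ ()
  ... | inj₂ (inj₁ (_ , p≡3)) | p≡7+t = 3≢7+ (trans (sym p≡3) p≡7+t)
    where
    3≢7+ : ∀ {y} → 3 ≢ 7 N.+ y
    3≢7+ ()
  ... | inj₂ (inj₂ (x>7+k , p≡pred)) | p≡7+t = NP.<-irrefl refl (NP.<-≤-trans (NP.+-monoʳ-< 7 (FP.toℕ<n t))
          (NP.≤-trans (NP.<⇒≤pred x>7+k) (NP.≤-reflexive (trans (sym p≡pred) p≡7+t))))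

  σ-pendant : ∀ t i → σ Γ i (pendant t) ≡ σ Γ i v6
  σ-pendant t i = trans (σ-leaf (k N.+ r) (pendant t) (7≤pendant t) (pendant-leaf t) i)
    (trans (cong (λ p → if p N.≡ᵇ toℕ i then plus else none) (parent-pendant t)) (sym (σ-v6 i)))
    where
    σ-v6 : ∀ i → σ Γ i v6 ≡ (if 0 N.≡ᵇ toℕ i then plus else none)
    σ-v6 = fin7+-cases (λ i → σ Γ i v6 ≡ (if 0 N.≡ᵇ toℕ i then plus else none)) refl refl refl refl refl refl refl λ s →
      trans (SignedGraph.sym Γ (tv s) v6) (trans (σ-base-tree (k N.+ r) v6 (NP.n<1+n 6) s)
        (cong (λ b → if b then plus else none)
          (≡ᵇ-false (parentA≢base k (7 N.+ toℕ s) 6 (NP.m≤m+n 7 (toℕ s)) (λ ()) (λ ()) (NP.n<1+n 6)))))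

  kernel : Fin k → Fin N → ℚ
  kernel t j = unit (pendant t) j Q.+ Q.- unit v6 j

  kernel-inKernel : ∀ t → InKernel Γ (kernel t)
  kernel-inKernel t = twins⇒inKernel Γ (pendant t) v6 (σ-pendant t)

  kernel-independent : LinIndep kernel
  kernel-independent = private-coordinates⇒independent kernel pendant one others
    where
    one : ∀ t → kernel t (pendant t) ≡ 1ℚ
    one t rewrite dec-true ((t F.↑ˡ r) FP.≟ (t F.↑ˡ r)) refl = refl
    others : ∀ t t′ → t′ ≢ t → kernel t′ (pendant t) ≡ 0ℚ
    others t t′ t′≢t rewrite dec-false ((t F.↑ˡ r) FP.≟ (t′ F.↑ˡ r)) (λ e → t′≢t (sym (FP.↑ˡ-injective r t t′ e))) = refl

  -- the vertex at distance i + 1 from 3 on the path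
  path : ∀ i → i < r → Fin N
  path i i<r = F.fromℕ< (NP.+-monoʳ-< 7 (NP.+-monoʳ-< k i<r))

  toℕ-path : ∀ i i<r → toℕ (path i i<r) ≡ 7 N.+ (k N.+ i)
  toℕ-path i i<r = FP.toℕ-fromℕ< (NP.+-monoʳ-< 7 (NP.+-monoʳ-< k i<r))

  7≤path : ∀ i i<r → 7 ≤ toℕ (path i i<r)
  7≤path i i<r = subst (7 ≤_) (sym (toℕ-path i i<r)) (NP.m≤m+n 7 (k N.+ i))

  parent-path₀ : ∀ 0<r → parentA k (toℕ (path 0 0<r)) ≡ 3
  parent-path₀ 0<r with parentA-cases k (toℕ (path 0 0<r))
  ... | inj₁ (lt , _) = ⊥-elim (NP.<⇒≱ lt (NP.≤-reflexive (sym (trans (toℕ-path 0 0<r) (cong (7 N.+_) (NP.+-identityʳ k))))))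
  ... | inj₂ (inj₁ (_ , p≡3)) = p≡3
  ... | inj₂ (inj₂ (gt , _)) = ⊥-elim (NP.<⇒≢ gt (sym (trans (toℕ-path 0 0<r) (cong (7 N.+_) (NP.+-identityʳ k)))))

  parent-path-suc : ∀ i i<r → parentA k (toℕ (path (suc i) i<r)) ≡ 7 N.+ (k N.+ i)
  parent-path-suc i i<r with parentA-cases k (toℕ (path (suc i) i<r))
  ... | inj₁ (lt , _) = ⊥-elim (NP.<⇒≱ lt (subst (7 N.+ k ≤_) (sym (toℕ-path (suc i) i<r)) (NP.+-monoʳ-≤ 7 (NP.m≤m+n k (suc i)))))
  ... | inj₂ (inj₁ (eq , _)) = ⊥-elim (NP.<-irrefl (sym eq) (subst (7 N.+ k <_) (sym (toℕ-path (suc i) i<r))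
                                  (NP.+-monoʳ-< 7 (subst (k <_) (sym (NP.+-suc k i)) (s≤s (NP.m≤m+n k i))))))
  ... | inj₂ (inj₂ (_ , p≡pred)) = trans p≡pred (cong N.pred (trans (toℕ-path (suc i) i<r) (cong (7 N.+_) (NP.+-suc k i))))

  σ-v3-path₀ : ∀ 0<r → σ Γ v3 (path 0 0<r) ≡ plus
  σ-v3-path₀ 0<r = trans (cong (λ p → Grown.entry (growthA k) p (toℕ (path 0 0<r))) (sym (parent-path₀ 0<r)))
    (entry-parent (toℕ (path 0 0<r)) (7≤path 0 0<r))

  no-tree-nbrs : ∀ (b : Fin N) → toℕ b < 7 → toℕ b ≢ 0 → toℕ b ≢ 3 → ∀ s → σ Γ b (tv s) ≡ none
  no-tree-nbrs b b<7 b≢0 b≢3 s = trans (σ-base-tree (k N.+ r) b b<7 s)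
    (cong (λ x → if x then plus else none) (≡ᵇ-false (parentA≢base k (7 N.+ toℕ s) (toℕ b) (NP.m≤m+n 7 (toℕ s)) b≢0 b≢3 b<7)))

  tree-vertex-cases : ∀ (s : Fin (k N.+ r)) → (Σ (Fin k) λ t → tv s ≡ pendant t) ⊎ (Σ ℕ λ i → Σ (i < r) λ i<r → tv s ≡ path i i<r)
  tree-vertex-cases s with toℕ s N.<? k
  ... | yes s<k = inj₁ (F.fromℕ< s<k , cong tv (FP.toℕ-injective (trans (sym (FP.toℕ-fromℕ< s<k)) (sym (FP.toℕ-↑ˡ (F.fromℕ< s<k) r)))))
  ... | no s≮k = inj₂ (toℕ s ∸ k , i<r , FP.toℕ-injective (trans (cong (7 N.+_) (sym k+i≡s)) (sym (toℕ-path (toℕ s ∸ k) i<r))))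
    where
    k+i≡s : k N.+ (toℕ s ∸ k) ≡ toℕ s
    k+i≡s = NP.m+[n∸m]≡n (NP.≮⇒≥ s≮k)
    i<r : toℕ s ∸ k < r
    i<r = NP.+-cancelˡ-< k (toℕ s ∸ k) r (subst (_< k N.+ r) (sym k+i≡s) (FP.toℕ<n s))

  path-parent≢0 : ∀ s i i<r → tv s ≡ path i i<r → parentA k (7 N.+ toℕ s) ≢ 0
  path-parent≢0 s i i<r s≡ p≡0 with parentA-cases k (7 N.+ toℕ s)
  ... | inj₁ (lt , _) = NP.<⇒≱ lt (subst (7 N.+ k ≤_) (sym (trans (sym (FP.toℕ-↑ʳ 7 s)) (trans (cong toℕ s≡) (toℕ-path i i<r))))
                                   (NP.+-monoʳ-≤ 7 (NP.m≤m+n k i)))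
  ... | inj₂ (inj₁ (_ , p≡3)) = 3≢0 (trans (sym p≡3) p≡0)
    where
    3≢0 : 3 ≢ 0
    3≢0 ()
  ... | inj₂ (inj₂ (gt , p≡pred)) = NP.<-irrefl refl (NP.<-≤-trans (s≤s z≤n)
          (NP.≤-trans (NP.≤-trans (NP.m≤m+n 7 k) (NP.<⇒≤pred gt)) (NP.≤-reflexive (trans (sym p≡pred) p≡0))))

  path-parent≢3 : ∀ s i i<r → tv s ≡ path (suc i) i<r → parentA k (7 N.+ toℕ s) ≢ 3
  path-parent≢3 s i i<r s≡ p≡3 = 7+≢3 (trans (sym (trans (cong (parentA k) (trans (sym (FP.toℕ-↑ʳ 7 s)) (cong toℕ s≡)))
                                                         (parent-path-suc i i<r))) p≡3)
    where
    7+≢3 : ∀ {y} → 7 N.+ y ≢ 3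
    7+≢3 ()

  -- the values of a kernel vector along 3, path 0, path 1, …, padded with zeros
  along : (Fin N → ℚ) → ℕ → ℚ
  along w zero = w v3
  along w (suc i) with i N.<? r
  ... | yes i<r = w (path i i<r)
  ... | no _ = 0ℚ

  along-path : ∀ w i i<r → along w (suc i) ≡ w (path i i<r)
  along-path w i i<r with i N.<? r
  ... | yes i<r′ = cong (λ p → w (path i p)) (NP.<-irrelevant i<r′ i<r)
  ... | no i≮r = ⊥-elim (i≮r i<r)

  along-beyond : ∀ w i → ¬ i < r → along w (suc i) ≡ 0ℚ
  along-beyond w i i≮r with i N.<? r
  ... | yes i<r = ⊥-elim (i≮r i<r)
  ... | no _ = refl

  -- the row of path i: its neighbours are the previous vertex P on 3, path 0, path 1, … and the next one, if any
  along-row-via : ∀ w → InKernel Γ w → ∀ i i<r (P : Fin N) → toℕ P ≡ parentA k (toℕ (path i i<r)) → w P ≡ along w i →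
    (∀ q → P ≢ path (suc i) q) → along w i Q.+ along w (suc (suc i)) ≡ 0ℚ
  along-row-via w ker i i<r P P≡ wP P≢next = by-next (suc i N.<? r)
    where
    J′ : Fin N
    J′ = path i i<r
    children-of-J : ∀ x → 7 ≤ toℕ x → parentA k (toℕ x) ≡ toℕ J′ → toℕ x ≡ 7 N.+ (k N.+ suc i)
    children-of-J x 7≤x px≡J with parentA-cases k (toℕ x)
    ... | inj₁ (_ , p≡0) = ⊥-elim (NP.<-irrefl refl (NP.<-≤-trans (s≤s z≤n)
                             (NP.≤-trans (7≤path i i<r) (NP.≤-reflexive (trans (sym px≡J) p≡0)))))
    ... | inj₂ (inj₁ (_ , p≡3)) = ⊥-elim (NP.<-irrefl refl (NP.<-≤-trans (s≤s (s≤s (s≤s (s≤s z≤n))))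
                                    (NP.≤-trans (7≤path i i<r) (NP.≤-reflexive (trans (sym px≡J) p≡3)))))
    ... | inj₂ (inj₂ (gt , p≡pred)) = trans (sym (NP.suc-pred (toℕ x) {{N.>-nonZero (NP.<-trans (s≤s z≤n) gt)}}))
          (trans (cong suc (trans (sym p≡pred) (trans px≡J (toℕ-path i i<r)))) (cong (7 N.+_) (sym (NP.+-suc k i))))
    row : ∀ Ch → (∀ x → 7 ≤ toℕ x → parentA k (toℕ x) ≡ toℕ J′ → x ∈ Ch) →
      (∀ c → c ∈ Ch → 7 ≤ toℕ c × parentA k (toℕ c) ≡ toℕ J′) → Unique (P ∷ Ch) →
      sumList (L.map w Ch) ≡ along w (suc (suc i)) → along w i Q.+ along w (suc (suc i)) ≡ 0ℚ
    row Ch children only-children u Ch≡ = trans (cong₂ Q._+_ (sym wP) (sym Ch≡))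
      (trans (sym (row-tree (k N.+ r) w J′ P Ch (7≤path i i<r) P≡ children only-children u)) (ker J′))
    by-next : Dec (suc i < r) → along w i Q.+ along w (suc (suc i)) ≡ 0ℚ
    by-next (yes next<r) = row (path (suc i) next<r ∷ [])
      (λ x 7≤x px≡J → here (FP.toℕ-injective (trans (children-of-J x 7≤x px≡J) (sym (toℕ-path (suc i) next<r)))))
      (λ { c (here refl) → 7≤path (suc i) next<r , trans (parent-path-suc i next<r) (sym (toℕ-path i i<r)) })
      ((P≢next next<r ∷ []) ∷ [] ∷ [])
      (trans (QP.+-identityʳ _) (sym (along-path w (suc i) next<r)))
    by-next (no next≮r) = row []
      (λ x 7≤x px≡J → ⊥-elim (next≮r (NP.+-cancelˡ-< k (suc i) r (NP.+-cancelˡ-< 7 (k N.+ suc i) (k N.+ r)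
                          (subst (_< N) (children-of-J x 7≤x px≡J) (FP.toℕ<n x))))))
      (λ _ ()) ([] ∷ []) (sym (along-beyond w (suc i) next≮r))

  along-row : ∀ w → InKernel Γ w → ∀ i → i < r → along w i Q.+ along w (suc (suc i)) ≡ 0ℚ
  along-row w ker zero 0<r = along-row-via w ker zero 0<r v3 (sym (parent-path₀ 0<r)) refl
    (λ q 3≡ → 3≢7+ (trans (cong toℕ 3≡) (toℕ-path 1 q)))
    where
    3≢7+ : ∀ {y} → 3 ≢ 7 N.+ y
    3≢7+ ()
  along-row w ker (suc i) i+1<r = along-row-via w ker (suc i) i+1<r (path i i<r) (trans (toℕ-path i i<r) (sym (parent-path-suc i i+1<r)))
    (sym (along-path w i i<r))
    (λ q eq → 2+≢ (NP.+-cancelˡ-≡ k i (suc (suc i)) (NP.+-cancelˡ-≡ 7 (k N.+ i) (k N.+ suc (suc i))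
                     (trans (sym (toℕ-path i i<r)) (trans (cong toℕ eq) (toℕ-path (suc (suc i)) q))))))
    where
    i<r : i < r
    i<r = NP.<-trans (NP.n<1+n i) i+1<r
    2+≢ : ∀ {y} → y ≢ suc (suc y)
    2+≢ ()

  pendants : List (Fin N)
  pendants = L.map pendant (L.allFin k)

  module Determined (w : Fin N → ℚ) (ker : InKernel Γ w) (vanish : ∀ t → w (pendant t) ≡ 0ℚ) where
    row : ∀ i (nbrs : List (Fin N)) → Unique nbrs → (∀ j → (j ∈ᵇ nbrs) ≡ false → σ Γ i j ≡ none) →
      sumList (L.map (λ j → scaled (σ Γ i j) (w j)) nbrs) ≡ 0ℚ
    row i nbrs u off = trans (sym (row-over Γ w i nbrs u off)) (ker i)
    drop0 : ∀ {x y} → x Q.+ (y Q.+ 0ℚ) ≡ 0ℚ → x Q.+ y ≡ 0ℚ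
    drop0 {x} {y} = subst (λ z → x Q.+ z ≡ 0ℚ) (QP.+-identityʳ y)
    w0≡0 : w v0 ≡ 0ℚ
    w0≡0 = trans (sym (QP.+-identityʳ (w v0))) (row v6 (v0 ∷ []) ([] ∷ [])
      (fin7+-cases (λ j → (j ∈ᵇ v0 ∷ []) ≡ false → σ Γ v6 j ≡ none)
        (λ ()) (λ _ → refl) (λ _ → refl) (λ _ → refl) (λ _ → refl) (λ _ → refl) (λ _ → refl)
        (λ s _ → no-tree-nbrs v6 (NP.n<1+n 6) (λ ()) (λ ()) s)))
    w2≡0 : w v2 ≡ 0ℚ
    w2≡0 = QP.neg-injective {w v2} {0ℚ} (x≡0⇒x+y≡0⇒y≡0 w0≡0 (drop0 {w v0} {Q.- w v2} (row v1 (v0 ∷ v2 ∷ []) (distinct! (v0 ∷ v2 ∷ []))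
      (fin7+-cases (λ j → (j ∈ᵇ v0 ∷ v2 ∷ []) ≡ false → σ Γ v1 j ≡ none)
        (λ ()) (λ _ → refl) (λ ()) (λ _ → refl) (λ _ → refl) (λ _ → refl) (λ _ → refl)
        (λ s _ → no-tree-nbrs v1 (s≤s (s≤s z≤n)) (λ ()) (λ ()) s)))))
    w1≡0 : w v1 ≡ 0ℚ
    w1≡0 = QP.neg-injective {w v1} {0ℚ} (x≡0⇒x+y≡0⇒y≡0 w0≡0 (drop0 {w v0} {Q.- w v1} (row v2 (v0 ∷ v1 ∷ []) (distinct! (v0 ∷ v1 ∷ []))
      (fin7+-cases (λ j → (j ∈ᵇ v0 ∷ v1 ∷ []) ≡ false → σ Γ v2 j ≡ none)
        (λ ()) (λ ()) (λ _ → refl) (λ _ → refl) (λ _ → refl) (λ _ → refl) (λ _ → refl)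
        (λ s _ → no-tree-nbrs v2 (s≤s (s≤s (s≤s z≤n))) (λ ()) (λ ()) s)))))
    w4≡-w3 : w v4 ≡ Q.- w v3
    w4≡-w3 = x+y≡0⇒y≡-x (drop0 {w v3} {w v4} (row v5 (v3 ∷ v4 ∷ []) (distinct! (v3 ∷ v4 ∷ []))
      (fin7+-cases (λ j → (j ∈ᵇ v3 ∷ v4 ∷ []) ≡ false → σ Γ v5 j ≡ none)
        (λ _ → refl) (λ _ → refl) (λ _ → refl) (λ ()) (λ ()) (λ _ → refl) (λ _ → refl)
        (λ s _ → no-tree-nbrs v5 (NP.≤-trans (NP.n≤1+n 6) (NP.n<1+n 6)) (λ ()) (λ ()) s))))
    w5≡-w3 : w v5 ≡ Q.- w v3
    w5≡-w3 = x+y≡0⇒y≡-x (drop0 {w v3} {w v5} (row v4 (v3 ∷ v5 ∷ []) (distinct! (v3 ∷ v5 ∷ []))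
      (fin7+-cases (λ j → (j ∈ᵇ v3 ∷ v5 ∷ []) ≡ false → σ Γ v4 j ≡ none)
        (λ _ → refl) (λ _ → refl) (λ _ → refl) (λ ()) (λ _ → refl) (λ ()) (λ _ → refl)
        (λ s _ → no-tree-nbrs v4 (s≤s (s≤s (s≤s (s≤s (s≤s z≤n))))) (λ ()) (λ ()) s))))
    on-pendant : ∀ b s t → tv s ≡ pendant t → entryℚ (σ Γ b (tv s)) Q.* w (tv s) ≡ 0ℚ
    on-pendant b s t s≡t = trans (cong (entryℚ (σ Γ b (tv s)) Q.*_) (trans (cong w s≡t) (vanish t))) (QP.*-zeroʳ (entryℚ (σ Γ b (tv s))))
    off-tree : ∀ (b : Fin N) → toℕ b < 7 → ∀ s → parentA k (7 N.+ toℕ s) ≢ toℕ b → entryℚ (σ Γ b (tv s)) Q.* w (tv s) ≡ 0ℚ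
    off-tree b b<7 s p≢b = trans (cong (λ e → entryℚ e Q.* w (tv s))
      (trans (σ-base-tree (k N.+ r) b b<7 s) (cong (λ x → if x then plus else none) (≡ᵇ-false p≢b)))) (QP.*-zeroˡ (w (tv s)))
    -- row 0: besides 3 and 6, the neighbours 1, 2 and the pendants carry zeros
    w6≡-w3 : w v6 ≡ Q.- w v3
    w6≡-w3 = x+y≡0⇒y≡-x (trans (cong₂ Q._+_ (sym (QP.*-identityˡ (w v3))) (sym (trans (QP.+-identityʳ _) (QP.*-identityˡ (w v6)))))
      (trans (sym (sum-over f₀ (v3 ∷ v6 ∷ []) (distinct! (v3 ∷ v6 ∷ []))
        (fin7+-cases (λ j → (j ∈ᵇ v3 ∷ v6 ∷ []) ≡ false → f₀ j ≡ 0ℚ)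
          (λ _ → QP.*-zeroˡ (w v0)) (λ _ → cong (1ℚ Q.*_) w1≡0)
          (λ _ → cong (1ℚ Q.*_) w2≡0) (λ ()) (λ _ → QP.*-zeroˡ (w v4)) (λ _ → QP.*-zeroˡ (w v5)) (λ ()) on-tree))) (ker v0)))
      where
      f₀ : Fin N → ℚ
      f₀ j = entryℚ (σ Γ v0 j) Q.* w j
      on-tree : ∀ s → (tv s ∈ᵇ v3 ∷ v6 ∷ []) ≡ false → f₀ (tv s) ≡ 0ℚ
      on-tree s _ with tree-vertex-cases s
      ... | inj₁ (t , s≡t) = on-pendant v0 s t s≡t
      ... | inj₂ (i , i<r , s≡i) = off-tree v0 (s≤s z≤n) s (path-parent≢0 s i i<r s≡i)
    row₃-without-path : ¬ 0 < r → w v0 Q.+ (w v4 Q.+ (w v5 Q.+ along w 1)) ≡ 0ℚ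
    row₃-without-path r≡0 = trans (cong (λ z → w v0 Q.+ (w v4 Q.+ (w v5 Q.+ z))) (along-beyond w 0 r≡0))
        (trans (cong₂ Q._+_ (sym (QP.*-identityˡ (w v0))) (cong₂ Q._+_ (sym (QP.*-identityˡ (w v4))) (cong (Q._+ 0ℚ) (sym (QP.*-identityˡ (w v5))))))
        (trans (sym (sum-over f₃ (v0 ∷ v4 ∷ v5 ∷ []) (distinct! (v0 ∷ v4 ∷ v5 ∷ []))
          (fin7+-cases (λ j → (j ∈ᵇ v0 ∷ v4 ∷ v5 ∷ []) ≡ false → f₃ j ≡ 0ℚ)
            (λ ()) (λ _ → QP.*-zeroˡ (w v1)) (λ _ → QP.*-zeroˡ (w v2))
            (λ _ → QP.*-zeroˡ (w v3)) (λ ()) (λ ()) (λ _ → QP.*-zeroˡ (w v6)) on-tree))) (ker v3)))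
      where
      f₃ : Fin N → ℚ
      f₃ j = entryℚ (σ Γ v3 j) Q.* w j
      on-tree : ∀ s → (tv s ∈ᵇ v0 ∷ v4 ∷ v5 ∷ []) ≡ false → f₃ (tv s) ≡ 0ℚ
      on-tree s _ with tree-vertex-cases s
      ... | inj₁ (t , s≡t) = on-pendant v3 s t s≡t
      ... | inj₂ (i , i<r , _) = ⊥-elim (r≡0 (NP.≤-<-trans z≤n i<r))
    row₃-with-path : 0 < r → w v0 Q.+ (w v4 Q.+ (w v5 Q.+ along w 1)) ≡ 0ℚ
    row₃-with-path 0<r = trans (cong (λ z → w v0 Q.+ (w v4 Q.+ (w v5 Q.+ z))) (along-path w 0 0<r))
        (trans (trans (solve 4 (λ a b c d → a :+ (b :+ (c :+ d)) := con 1ℚ :* a :+ (con 1ℚ :* b :+ (con 1ℚ :* c :+ (con 1ℚ :* d :+ con 0ℚ))))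
                               refl (w v0) (w v4) (w v5) (w h₀))
                       (cong (λ e → 1ℚ Q.* w v0 Q.+ (1ℚ Q.* w v4 Q.+ (1ℚ Q.* w v5 Q.+ (entryℚ e Q.* w h₀ Q.+ 0ℚ)))) (sym (σ-v3-path₀ 0<r))))
        (trans (sym (sum-over f₃ (v0 ∷ v4 ∷ v5 ∷ h₀ ∷ []) distinct-nbrs
          (fin7+-cases (λ j → (j ∈ᵇ v0 ∷ v4 ∷ v5 ∷ h₀ ∷ []) ≡ false → f₃ j ≡ 0ℚ)
            (λ ()) (λ _ → QP.*-zeroˡ (w v1)) (λ _ → QP.*-zeroˡ (w v2))
            (λ _ → QP.*-zeroˡ (w v3)) (λ ()) (λ ()) (λ _ → QP.*-zeroˡ (w v6)) on-tree))) (ker v3)))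
      where
      h₀ : Fin N
      h₀ = path 0 0<r
      f₃ : Fin N → ℚ
      f₃ j = entryℚ (σ Γ v3 j) Q.* w j
      base≢h₀ : ∀ (b : Fin N) → toℕ b < 7 → b ≢ h₀
      base≢h₀ b b<7 b≡h₀ = NP.<⇒≱ b<7 (subst (7 ≤_) (cong toℕ (sym b≡h₀)) (7≤path 0 0<r))
      distinct-nbrs : Unique (v0 ∷ v4 ∷ v5 ∷ h₀ ∷ [])
      distinct-nbrs = ((λ ()) ∷ (λ ()) ∷ base≢h₀ v0 (s≤s z≤n) ∷ []) ∷
                      ((λ ()) ∷ base≢h₀ v4 (s≤s (s≤s (s≤s (s≤s (s≤s z≤n))))) ∷ []) ∷
                      (base≢h₀ v5 (s≤s (s≤s (s≤s (s≤s (s≤s (s≤s z≤n)))))) ∷ []) ∷ [] ∷ []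
      on-tree : ∀ s → (tv s ∈ᵇ v0 ∷ v4 ∷ v5 ∷ h₀ ∷ []) ≡ false → f₃ (tv s) ≡ 0ℚ
      on-tree s s∉ with tree-vertex-cases s
      ... | inj₁ (t , s≡t) = on-pendant v3 s t s≡t
      ... | inj₂ (zero , i<r , s≡h₀) =
        ⊥-elim (∈ᵇ-false⇒∉ {L = v0 ∷ v4 ∷ v5 ∷ h₀ ∷ []} s∉ (there (there (there (here (trans s≡h₀ (cong (path 0) (NP.<-irrelevant i<r 0<r))))))))
      ... | inj₂ (suc i , i<r , s≡i) = off-tree v3 (s≤s (s≤s (s≤s (s≤s z≤n)))) s (path-parent≢3 s i i<r s≡i)
    row₃ : w v0 Q.+ (w v4 Q.+ (w v5 Q.+ along w 1)) ≡ 0ℚ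
    row₃ = by-path (0 N.<? r)
      where
      by-path : Dec (0 < r) → w v0 Q.+ (w v4 Q.+ (w v5 Q.+ along w 1)) ≡ 0ℚ
      by-path (yes 0<r) = row₃-with-path 0<r
      by-path (no r≡0) = row₃-without-path r≡0
    along₁ : along w 1 ≡ (1ℚ Q.+ 1ℚ) Q.* w v3
    along₁ = begin
      along w 1                                                            ≡⟨ solve 2 (λ a h → h := (con 0ℚ :+ (:- a :+ (:- a :+ h))) :+ (con 1ℚ :+ con 1ℚ) :* a) refl (w v3) (along w 1) ⟩
      (0ℚ Q.+ (Q.- w v3 Q.+ (Q.- w v3 Q.+ along w 1))) Q.+ (1ℚ Q.+ 1ℚ) Q.* w v3
                                                                           ≡⟨ cong (Q._+ (1ℚ Q.+ 1ℚ) Q.* w v3) (trans (cong₂ Q._+_ (sym w0≡0)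
                                                                                (cong₂ (λ a b → a Q.+ (b Q.+ along w 1)) (sym w4≡-w3) (sym w5≡-w3))) row₃) ⟩
      0ℚ Q.+ (1ℚ Q.+ 1ℚ) Q.* w v3                                          ≡⟨ QP.+-identityˡ _ ⟩
      (1ℚ Q.+ 1ℚ) Q.* w v3                                                 ∎
      where open ≡-Reasoning
    along≡ : ∀ i → i ≤ suc r → along w i ≡ coefficient i Q.* w v3
    along≡ zero _ = sym (QP.*-identityˡ (w v3))
    along≡ (suc zero) _ = along₁
    along≡ (suc (suc i)) i+2≤ = begin
      along w (suc (suc i))           ≡⟨ x+y≡0⇒y≡-x (along-row w ker i (NP.≤-pred i+2≤)) ⟩
      Q.- along w i                   ≡⟨ cong Q.-_ (along≡ i (NP.≤-trans (NP.n≤1+n i) (NP.≤-trans (NP.n≤1+n (suc i)) i+2≤))) ⟩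
      Q.- (coefficient i Q.* w v3)    ≡⟨ QP.neg-distribˡ-* (coefficient i) (w v3) ⟩
      coefficient (suc (suc i)) Q.* w v3 ∎
      where open ≡-Reasoning
    -- the path ends: the value after its last vertex is 0
    w3≡0 : w v3 ≡ 0ℚ
    w3≡0 = a*x≡0⇒x≡0 (coefficient≢0 (suc r)) (trans (sym (along≡ (suc r) NP.≤-refl)) (along-beyond w r (NP.<-irrefl refl)))
    -w3≡0 : Q.- w v3 ≡ 0ℚ
    -w3≡0 = cong Q.-_ w3≡0
    w4≡0 : w v4 ≡ 0ℚ
    w4≡0 = trans w4≡-w3 -w3≡0
    w5≡0 : w v5 ≡ 0ℚ
    w5≡0 = trans w5≡-w3 -w3≡0
    w6≡0 : w v6 ≡ 0ℚ
    w6≡0 = trans w6≡-w3 -w3≡0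
    tree≡0 : ∀ s → w (tv s) ≡ 0ℚ
    tree≡0 s with tree-vertex-cases s
    ... | inj₁ (t , s≡t) = trans (cong w s≡t) (vanish t)
    ... | inj₂ (i , i<r , s≡i) = trans (cong w s≡i) (trans (sym (along-path w i i<r))
          (trans (along≡ (suc i) (s≤s (NP.<⇒≤ i<r))) (trans (cong (coefficient (suc i) Q.*_) w3≡0) (QP.*-zeroʳ (coefficient (suc i))))))


    vanishes : ∀ j → w j ≡ 0ℚ
    vanishes = fin7+-cases (λ j → w j ≡ 0ℚ) w0≡0 w1≡0 w2≡0 w3≡0 w4≡0 w5≡0 w6≡0 tree≡0

  determined : KernelDeterminedOn Γ pendants
  determined w ker on-pendants = Determined.vanishes w ker (λ t → on-pendants (pendant t) (∈-map⁺ pendant (∈-allFin t)))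

  nullity : Nullity Γ k
  nullity = (kernel , kernel-inKernel , kernel-independent) ,
    λ m indep → subst (m ≤_) (trans (LP.length-map pendant (L.allFin k)) (LP.length-tabulate (λ t → t)))
                  (nullity≤ Γ pendants determined m indep)

realised : ∀ m k → k ≤ suc m → Realised (7 N.+ m) k
realised m k k≤1+m with NP.m≤n⇒m<n∨m≡n k≤1+m
... | inj₂ refl = Γ , (bicyclic , infinity) , unbalanced , nullity
  where open FamilyB m
... | inj₁ (s≤s k≤m) = subst (λ l → Realised (7 N.+ l) k) (NP.m+[n∸m]≡n k≤m) (Γ , (bicyclic , infinity) , unbalanced , nullity)
  where open FamilyA k (m ∸ k)

theorem5p4 : (n : ℕ) → 7 ≤ n → (k : ℕ) →
    (∃ λ (Γ : SignedGraph n) → InBnPlus Γ × Unbalanced Γ × Nullity Γ k) ⇔ (k ≤ n ∸ 6)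
theorem5p4 n n≥7@(s≤s (s≤s (s≤s (s≤s (s≤s (s≤s (s≤s (z≤n {m})))))))) k = mk⇔ (nullity≤n∸6 n n≥7 k) (realised m k)
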